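{- The number of extremal rays of ${\sf Kostka}_r$ is $\binom{r}{3}+\binom{r}{2}+\binom{r}{1}$.
   Context: Fix a positive integer $r$. ${\sf Kostka}_r$ is the polyhedral cone of $(\lambda,\mu)\in\mathbb{R}^{2r}$ with $\lambda_1\ge\cdots\ge\lambda_r\ge0$, $\mu_1\ge\cdots\ge\mu_r\ge0$, $\sum_{i=1}^t\lambda_i\ge\sum_{i=1}^t\mu_i$ for $1\le t\le r-1$, and $\sum_{i=1}^r\lambda_i=\sum_{i=1}^r\mu_i$. An extremal ray is a one-dimensional face of this cone.
   Formalization: The cone ${\sf Kostka}_r$ is taken in ℚ^(2r) instead of $\mathbb{R}^{2r}$, so the supporting functionals cutting out its faces and the vectors spanning its extremal rays have rational coordinates. -}

module Defs where

open import Data.Nat using (ℕ; zero; suc; _<ᵇ_)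
import Data.Nat as ℕ
open import Data.Fin using (Fin; zero; suc; toℕ)
open import Data.Rational using (ℚ; 0ℚ; _+_; _*_; _≤_)
open import Data.Bool using (if_then_else_)
open import Data.Product using (_×_; ∃; Σ; _,_)
open import Relation.Binary.PropositionalEquality using (_≡_)
open import Relation.Nullary using (¬_)

sumᶠ : ∀ {n} → (Fin n → ℚ) → ℚ
sumᶠ {zero}  f = 0ℚ
sumᶠ {suc n} f = f zero + sumᶠ (λ i → f (suc i))

-- prefix sum  f 1 + ... + f t  (1-based in the paper; here indices i with toℕ i < t)
psum : ∀ {r} → ℕ → (Fin r → ℚ) → ℚ
psum t f = sumᶠ (λ i → if toℕ i <ᵇ t then f i else 0ℚ)

Pt : ℕ → Set
Pt r = (Fin r → ℚ) × (Fin r → ℚ)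

Partition : ∀ {r} → (Fin r → ℚ) → Set
Partition {r} l = (∀ (i j : Fin r) → toℕ i ℕ.≤ toℕ j → l j ≤ l i) × (∀ i → 0ℚ ≤ l i)

InKostka : ∀ {r} → Pt r → Set
InKostka {r} (l , m) =
  Partition l × Partition m ×
  (∀ t → 1 ℕ.≤ t → t ℕ.≤ r ℕ.∸ 1 → psum t m ≤ psum t l) ×
  psum r l ≡ psum r m

dot : ∀ {r} → Pt r → Pt r → ℚ
dot (a , b) (c , d) = sumᶠ (λ i → a i * c i) + sumᶠ (λ i → b i * d i)

scale : ∀ {r} → ℚ → Pt r → Pt r
scale t (a , b) = (λ i → t * a i) , (λ i → t * b i)

_≈_ : ∀ {r} → Pt r → Pt r → Set
(a , b) ≈ (c , d) = (∀ i → a i ≡ c i) × (∀ i → b i ≡ d i)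

zeroPt : ∀ {r} → Pt r
zeroPt = (λ _ → 0ℚ) , (λ _ → 0ℚ)

Ray : ∀ {r} → Pt r → Pt r → Set
Ray u x = ∃ λ t → 0ℚ ≤ t × x ≈ scale t u

Supporting : ∀ {r} → Pt r → Set
Supporting w = ∀ x → InKostka x → 0ℚ ≤ dot w x

Face : ∀ {r} → Pt r → Pt r → Set
Face w x = InKostka x × dot w x ≡ 0ℚ

IsExtremalRay : ∀ {r} → Pt r → Set
IsExtremalRay u =
  ¬ (u ≈ zeroPt) ×
  ∃ λ w → Supporting w × (∀ x → (Face w x → Ray u x) × (Ray u x → Face w x))

SameRay : ∀ {r} → Pt r → Pt r → Set
SameRay u v = Ray u v × Ray v u

HasExactlyNExtremalRays : ℕ → ℕ → Set
HasExactlyNExtremalRays r N =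
  Σ (Fin N → Pt r) λ g →
    (∀ i → IsExtremalRay (g i)) ×
    (∀ i j → SameRay (g i) (g j) → i ≡ j) ×
    (∀ u → IsExtremalRay u → ∃ λ i → SameRay u (g i))

-- Kostka_r is cut out by the 3r inequalities λ_k ≥ λ_{k+1}, μ_k ≥ μ_{k+1} (with λ_r = μ_r = 0) and
-- D_t := Σ_{i<t} (λ_i - μ_i) ≥ 0 for t < r, together with D_r = 0.  Its extremal rays are spanned by
-- the r vectors (1^a, 1^a), 1 ≤ a ≤ r, and the C(r+1, 3) = C(r, 3) + C(r, 2) vectors
-- ((c-b)·1^a, (c-a)·1^b + (a-b)·1^c), 0 ≤ b < a < c ≤ r, where 1^a is the indicator of [0, a).
--
-- Every nonzero point x of the cone has a generator g all of whose strict inequalities are strict at x;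
-- subtracting the largest multiple of g that stays in the cone makes one more inequality tight, so by
-- induction x is a nonnegative combination of generators.  Two distinct generators are separated by an
-- inequality that is tight on the first and strict on the second, so the sum of the inequalities tight
-- on g defines a supporting hyperplane whose face is exactly the ray of g.  Conversely, the face of an
-- extremal ray contains every generator occurring in a decomposition of its spanning vector.
module Submission where

open import Defs
open import Data.Nat using (ℕ; _+_; _≤_)
open import Data.Nat.Combinatorics using (_C_)

open import Data.Bool using (true; false; if_then_else_)
open import Data.Empty using (⊥-elim)
open import Data.Fin as Fin using (Fin; toℕ)
open import Data.List using (List; []; _∷_; _++_; map; upTo; filter; length; lookup)
import Data.List.Properties as Listₚ
open import Data.List.Membership.Propositional using (_∈_)
open import Data.List.Membership.Propositional.Properties
  using (∈-++⁺ˡ; ∈-++⁺ʳ; ∈-++⁻; ∈-map⁺; ∈-map⁻; ∈-upTo⁺; ∈-upTo⁻; ∈-filter⁺; ∈-filter⁻; ∈-lookup)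
open import Data.List.Relation.Unary.All as All using (All; []; _∷_)
open import Data.List.Relation.Unary.Any using (here; there; index)
open import Data.List.Relation.Unary.Any.Properties using (lookup-index)
open import Data.List.Relation.Unary.Unique.Propositional using (Unique; []; _∷_)
import Data.List.Relation.Unary.Unique.Propositional.Properties as Uniqueₚ
open import Data.Nat using (zero; suc; pred; _∸_; _*_; _<_; _⊓_; _<ᵇ_; _≡ᵇ_; z≤n; s≤s)
import Data.Nat as ℕ
open import Data.Nat.Combinatorics using (nCk+nC[k+1]≡[n+1]C[k+1]; nC1≡n)
import Data.Nat.Properties as ℕₚ
open import Data.Nat.Tactic.RingSolver using (solve-∀)
open import Data.Product using (_×_; ∃; Σ; _,_; proj₁; proj₂)
open import Data.Rational as ℚ using (ℚ; 0ℚ; 1ℚ)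
import Data.Rational.Properties as ℚₚ
open import Data.Rational.Solver using (module +-*-Solver)
open import Data.Sum using (_⊎_; inj₁; inj₂; [_,_]′)
open import Function using (_∘_; _⇔_; mk⇔; module Equivalence)
open import Relation.Binary.Bundles using (DecTotalOrder)
open import Relation.Binary.Definitions using (tri<; tri≈; tri>)
open import Relation.Binary.PropositionalEquality
open import Relation.Nullary using (¬_; yes; no; Dec)

open import Data.List.Extrema (DecTotalOrder.totalOrder ℚₚ.≤-decTotalOrder)
  using (argmin; argmin-all; f[argmin]≤f[xs])
open +-*-Solver using (_:+_; _:-_; :-_; _:*_; _:=_) renaming (solve to solveℚ)

private
  variable
    r k n t : ℕ
    p q : ℚ

-- ℚ arithmetic

p≤q⇒0≤q-p : p ℚ.≤ q → 0ℚ ℚ.≤ q ℚ.- p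
p≤q⇒0≤q-p {p = p} {q = q} p≤q = subst (ℚ._≤ q ℚ.- p) (ℚₚ.+-inverseʳ p) (ℚₚ.+-monoˡ-≤ (ℚ.- p) p≤q)

p<q⇒0<q-p : p ℚ.< q → 0ℚ ℚ.< q ℚ.- p
p<q⇒0<q-p {p = p} {q = q} p<q = subst (ℚ._< q ℚ.- p) (ℚₚ.+-inverseʳ p) (ℚₚ.+-monoˡ-< (ℚ.- p) p<q)

q-p+p≡q : ∀ p q → (q ℚ.- p) ℚ.+ p ≡ q
q-p+p≡q = solveℚ 2 (λ p q → (q :- p) :+ p := q) refl

0≤q-p⇒p≤q : 0ℚ ℚ.≤ q ℚ.- p → p ℚ.≤ q
0≤q-p⇒p≤q {q = q} {p = p} h = subst₂ ℚ._≤_ (ℚₚ.+-identityˡ p) (q-p+p≡q p q) (ℚₚ.+-monoˡ-≤ p h)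

0<q-p⇒p<q : 0ℚ ℚ.< q ℚ.- p → p ℚ.< q
0<q-p⇒p<q {q = q} {p = p} h = subst₂ ℚ._<_ (ℚₚ.+-identityˡ p) (q-p+p≡q p q) (ℚₚ.+-monoˡ-< p h)

p-q≡0⇒p≡q : p ℚ.- q ≡ 0ℚ → p ≡ q
p-q≡0⇒p≡q {p = p} {q = q} p-q≡0 = trans (sym (q-p+p≡q q p)) (trans (cong (ℚ._+ q) p-q≡0) (ℚₚ.+-identityˡ q))

0≤q⇒p-q≤p : 0ℚ ℚ.≤ q → p ℚ.- q ℚ.≤ p
0≤q⇒p-q≤p {q = q} {p = p} q≥0 = subst (p ℚ.- q ℚ.≤_) (ℚₚ.+-identityʳ p) (ℚₚ.+-monoʳ-≤ p (ℚₚ.neg-antimono-≤ q≥0))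

+-interchange : ∀ a b c d → (a ℚ.+ b) ℚ.+ (c ℚ.+ d) ≡ (a ℚ.+ c) ℚ.+ (b ℚ.+ d)
+-interchange = solveℚ 4 (λ a b c d → (a :+ b) :+ (c :+ d) := (a :+ c) :+ (b :+ d)) refl

+-nonNeg : 0ℚ ℚ.≤ p → 0ℚ ℚ.≤ q → 0ℚ ℚ.≤ p ℚ.+ q
+-nonNeg = ℚₚ.+-mono-≤

+-posˡ : 0ℚ ℚ.< p → 0ℚ ℚ.≤ q → 0ℚ ℚ.< p ℚ.+ q
+-posˡ = ℚₚ.+-mono-<-≤

+-posʳ : 0ℚ ℚ.≤ p → 0ℚ ℚ.< q → 0ℚ ℚ.< p ℚ.+ q
+-posʳ = ℚₚ.+-mono-≤-<

*-nonNeg : 0ℚ ℚ.≤ p → 0ℚ ℚ.≤ q → 0ℚ ℚ.≤ p ℚ.* q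
*-nonNeg {p = p} {q = q} p≥0 q≥0 =
  ℚₚ.nonNegative⁻¹ _ {{ℚₚ.nonNeg*nonNeg⇒nonNeg p {{ℚ.nonNegative p≥0}} q {{ℚ.nonNegative q≥0}}}}

*-pos : 0ℚ ℚ.< p → 0ℚ ℚ.< q → 0ℚ ℚ.< p ℚ.* q
*-pos {p = p} {q = q} p>0 q>0 = ℚₚ.positive⁻¹ _ {{ℚₚ.pos*pos⇒pos p {{ℚ.positive p>0}} q {{ℚ.positive q>0}}}}

nonNeg+nonNeg≡0 : 0ℚ ℚ.≤ p → 0ℚ ℚ.≤ q → p ℚ.+ q ≡ 0ℚ → p ≡ 0ℚ × q ≡ 0ℚ
nonNeg+nonNeg≡0 {p = p} {q = q} p≥0 q≥0 p+q≡0 =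
  ℚₚ.≤-antisym p≤0 p≥0 ,
  ℚₚ.≤-antisym (subst₂ ℚ._≤_ (ℚₚ.+-identityˡ q) p+q≡0 (ℚₚ.+-monoˡ-≤ q p≥0)) q≥0
  where
  p≤0 : p ℚ.≤ 0ℚ
  p≤0 = subst₂ ℚ._≤_ (ℚₚ.+-identityʳ p) p+q≡0 (ℚₚ.+-monoʳ-≤ p q≥0)

pos*q≡0⇒q≡0 : 0ℚ ℚ.< p → p ℚ.* q ≡ 0ℚ → q ≡ 0ℚ
pos*q≡0⇒q≡0 {p = p} {q = q} p>0 pq≡0 with ℚₚ.<-cmp q 0ℚ
... | tri≈ _ q≡0 _ = q≡0
... | tri< q<0 _ _ =
  ⊥-elim (ℚₚ.<-irrefl pq≡0 (subst (p ℚ.* q ℚ.<_) (ℚₚ.*-zeroʳ p) (ℚₚ.*-monoʳ-<-pos p {{ℚ.positive p>0}} q<0)))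
... | tri> _ _ q>0 = ⊥-elim (ℚₚ.<-irrefl (sym pq≡0) (*-pos p>0 q>0))

0≤p∧p≢0⇒0<p : 0ℚ ℚ.≤ p → p ≢ 0ℚ → 0ℚ ℚ.< p
0≤p∧p≢0⇒0<p {p = p} p≥0 p≢0 with ℚₚ.<-cmp 0ℚ p
... | tri< 0<p _ _ = 0<p
... | tri≈ _ 0≡p _ = ⊥-elim (p≢0 (sym 0≡p))
... | tri> _ _ p<0 = ⊥-elim (ℚₚ.<-irrefl refl (ℚₚ.<-≤-trans p<0 p≥0))

fromℕ : ℕ → ℚ
fromℕ zero    = 0ℚ
fromℕ (suc n) = 1ℚ ℚ.+ fromℕ n

fromℕ-+ : ∀ m n → fromℕ (m + n) ≡ fromℕ m ℚ.+ fromℕ n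
fromℕ-+ zero    n = sym (ℚₚ.+-identityˡ (fromℕ n))
fromℕ-+ (suc m) n = trans (cong (1ℚ ℚ.+_) (fromℕ-+ m n)) (sym (ℚₚ.+-assoc 1ℚ (fromℕ m) (fromℕ n)))

fromℕ-∸ : ∀ {m n} → n ≤ m → fromℕ (m ∸ n) ≡ fromℕ m ℚ.- fromℕ n
fromℕ-∸ {m} {n} n≤m = begin
  fromℕ (m ∸ n)                              ≡⟨ p+q-q≡p (fromℕ (m ∸ n)) (fromℕ n) ⟩
  (fromℕ (m ∸ n) ℚ.+ fromℕ n) ℚ.- fromℕ n    ≡⟨ cong (ℚ._- fromℕ n) (sym (fromℕ-+ (m ∸ n) n)) ⟩
  fromℕ (m ∸ n + n) ℚ.- fromℕ n              ≡⟨ cong (λ z → fromℕ z ℚ.- fromℕ n) (ℕₚ.m∸n+n≡m n≤m) ⟩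
  fromℕ m ℚ.- fromℕ n                        ∎
  where
  open ≡-Reasoning
  p+q-q≡p : ∀ p q → p ≡ (p ℚ.+ q) ℚ.- q
  p+q-q≡p = solveℚ 2 (λ p q → p := (p :+ q) :- q) refl

fromℕ-nonNeg : ∀ n → 0ℚ ℚ.≤ fromℕ n
fromℕ-nonNeg zero    = ℚₚ.≤-refl
fromℕ-nonNeg (suc n) = +-nonNeg (ℚₚ.<⇒≤ (ℚₚ.positive⁻¹ 1ℚ)) (fromℕ-nonNeg n)

fromℕ-pos : 0 < n → 0ℚ ℚ.< fromℕ n
fromℕ-pos {suc n} _ = +-posˡ (ℚₚ.positive⁻¹ 1ℚ) (fromℕ-nonNeg n)

-- Finite sums and prefix sums

sumᶠ-cong : {f g : Fin n → ℚ} → (∀ i → f i ≡ g i) → sumᶠ f ≡ sumᶠ g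
sumᶠ-cong {zero}  f≗g = refl
sumᶠ-cong {suc n} f≗g = cong₂ ℚ._+_ (f≗g Fin.zero) (sumᶠ-cong (f≗g ∘ Fin.suc))

sumᶠ-zero : sumᶠ {n} (λ _ → 0ℚ) ≡ 0ℚ
sumᶠ-zero {zero}  = refl
sumᶠ-zero {suc n} = trans (ℚₚ.+-identityˡ _) (sumᶠ-zero {n})

sumᶠ-zeroˡ : (f : Fin r → ℚ) → sumᶠ (λ i → 0ℚ ℚ.* f i) ≡ 0ℚ
sumᶠ-zeroˡ {r} f = trans (sumᶠ-cong (ℚₚ.*-zeroˡ ∘ f)) (sumᶠ-zero {r})

sumᶠ-zeroʳ : (f : Fin r → ℚ) → sumᶠ (λ i → f i ℚ.* 0ℚ) ≡ 0ℚ
sumᶠ-zeroʳ {r} f = trans (sumᶠ-cong (ℚₚ.*-zeroʳ ∘ f)) (sumᶠ-zero {r})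

sumᶠ-+ : (f g : Fin n → ℚ) → sumᶠ (λ i → f i ℚ.+ g i) ≡ sumᶠ f ℚ.+ sumᶠ g
sumᶠ-+ {zero}  f g = sym (ℚₚ.+-identityʳ 0ℚ)
sumᶠ-+ {suc n} f g = trans (cong (f Fin.zero ℚ.+ g Fin.zero ℚ.+_) (sumᶠ-+ (f ∘ Fin.suc) (g ∘ Fin.suc)))
  (+-interchange (f Fin.zero) (g Fin.zero) (sumᶠ (f ∘ Fin.suc)) (sumᶠ (g ∘ Fin.suc)))

sumᶠ-* : ∀ c (f : Fin n → ℚ) → sumᶠ (λ i → c ℚ.* f i) ≡ c ℚ.* sumᶠ f
sumᶠ-* {zero}  c f = sym (ℚₚ.*-zeroʳ c)
sumᶠ-* {suc n} c f = trans (cong (c ℚ.* f Fin.zero ℚ.+_) (sumᶠ-* c (f ∘ Fin.suc)))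
  (sym (ℚₚ.*-distribˡ-+ c (f Fin.zero) (sumᶠ (f ∘ Fin.suc))))

sumᶠ-neg : (f : Fin n → ℚ) → sumᶠ (λ i → ℚ.- f i) ≡ ℚ.- sumᶠ f
sumᶠ-neg {zero}  f = refl
sumᶠ-neg {suc n} f = trans (cong (ℚ.- f Fin.zero ℚ.+_) (sumᶠ-neg (f ∘ Fin.suc)))
  (sym (ℚₚ.neg-distrib-+ (f Fin.zero) (sumᶠ (f ∘ Fin.suc))))

sumᶠ-+-interchange : (f g f′ g′ : Fin r → ℚ) →
                     sumᶠ (λ i → f i ℚ.+ g i) ℚ.+ sumᶠ (λ i → f′ i ℚ.+ g′ i) ≡
                     (sumᶠ f ℚ.+ sumᶠ f′) ℚ.+ (sumᶠ g ℚ.+ sumᶠ g′)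
sumᶠ-+-interchange f g f′ g′ = trans (cong₂ ℚ._+_ (sumᶠ-+ f g) (sumᶠ-+ f′ g′))
  (+-interchange (sumᶠ f) (sumᶠ g) (sumᶠ f′) (sumᶠ g′))

-- Out of range, entries are 0, matching the convention λᵢ = μᵢ = 0 for i ≥ r.
at : (Fin r → ℚ) → ℕ → ℚ
at {zero}  f k       = 0ℚ
at {suc r} f zero    = f Fin.zero
at {suc r} f (suc k) = at (f ∘ Fin.suc) k

at-toℕ : (f : Fin r → ℚ) (i : Fin r) → at f (toℕ i) ≡ f i
at-toℕ f Fin.zero    = refl
at-toℕ f (Fin.suc i) = at-toℕ (f ∘ Fin.suc) i

at-≥ : (f : Fin r → ℚ) → r ≤ k → at f k ≡ 0ℚ
at-≥ {zero}              f _         = refl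
at-≥ {suc r} {k = suc k} f (s≤s r≤k) = at-≥ (f ∘ Fin.suc) r≤k

at-∘toℕ : (g : ℕ → ℚ) → (∀ k → r ≤ k → g k ≡ 0ℚ) → ∀ k → at {r} (g ∘ toℕ) k ≡ g k
at-∘toℕ {zero}  g g≥r k       = sym (g≥r k z≤n)
at-∘toℕ {suc r} g g≥r zero    = refl
at-∘toℕ {suc r} g g≥r (suc k) = at-∘toℕ (g ∘ suc) (λ k r≤k → g≥r (suc k) (s≤s r≤k)) k

psum-zero : (f : Fin r → ℚ) → psum 0 f ≡ 0ℚ
psum-zero {r} f = sumᶠ-zero {r}

psum-suc : (f : Fin r → ℚ) → ∀ t → psum (suc t) f ≡ psum t f ℚ.+ at f t
psum-suc {zero}  f t = sym (ℚₚ.+-identityʳ 0ℚ)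
psum-suc {suc r} f zero = begin
  f Fin.zero ℚ.+ psum 0 (f ∘ Fin.suc)  ≡⟨ cong (f Fin.zero ℚ.+_) (psum-zero (f ∘ Fin.suc)) ⟩
  f Fin.zero ℚ.+ 0ℚ                    ≡⟨ ℚₚ.+-comm (f Fin.zero) 0ℚ ⟩
  0ℚ ℚ.+ f Fin.zero                    ≡⟨ cong (ℚ._+ f Fin.zero) (sym (psum-zero f)) ⟩
  psum 0 f ℚ.+ f Fin.zero              ∎
  where open ≡-Reasoning
psum-suc {suc r} f (suc t) = trans (cong (f Fin.zero ℚ.+_) (psum-suc (f ∘ Fin.suc) t))
  (sym (ℚₚ.+-assoc (f Fin.zero) (psum t (f ∘ Fin.suc)) (at (f ∘ Fin.suc) t)))

psum-≥ : (f : Fin r → ℚ) → r ≤ t → psum t f ≡ psum r f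
psum-≥ {r} f r≤t with ℕₚ.m≤n⇒∃[o]m+o≡n r≤t
... | d , refl = stable d
  where
  stable : ∀ d → psum (r + d) f ≡ psum r f
  stable zero    = cong (λ t → psum t f) (ℕₚ.+-identityʳ r)
  stable (suc d) = begin
    psum (r + suc d) f                  ≡⟨ cong (λ t → psum t f) (ℕₚ.+-suc r d) ⟩
    psum (suc (r + d)) f                ≡⟨ psum-suc f (r + d) ⟩
    psum (r + d) f ℚ.+ at f (r + d)     ≡⟨ cong₂ ℚ._+_ (stable d) (at-≥ f (ℕₚ.m≤m+n r d)) ⟩
    psum r f ℚ.+ 0ℚ                     ≡⟨ ℚₚ.+-identityʳ _ ⟩
    psum r f                            ∎
    where open ≡-Reasoning

at-fromℕ : (shape : ℕ → ℕ) → (∀ {k} → r ≤ k → shape k ≡ 0) →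
           ∀ k → at {r} (fromℕ ∘ shape ∘ toℕ) k ≡ fromℕ (shape k)
at-fromℕ shape vanish = at-∘toℕ (fromℕ ∘ shape) (λ k r≤k → cong fromℕ (vanish r≤k))

partialSum : (ℕ → ℕ) → ℕ → ℕ
partialSum G zero    = 0
partialSum G (suc t) = partialSum G t + G t

psum-fromℕ : (G : ℕ → ℕ) → (∀ {k} → r ≤ k → G k ≡ 0) →
             ∀ t → psum {r} t (fromℕ ∘ G ∘ toℕ) ≡ fromℕ (partialSum G t)
psum-fromℕ {r} G G≥r zero    = psum-zero {r} (fromℕ ∘ G ∘ toℕ)
psum-fromℕ {r} G G≥r (suc t) = begin
  psum (suc t) g                          ≡⟨ psum-suc g t ⟩
  psum t g ℚ.+ at g t                     ≡⟨ cong₂ ℚ._+_ (psum-fromℕ G G≥r t) (at-fromℕ G G≥r t) ⟩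
  fromℕ (partialSum G t) ℚ.+ fromℕ (G t)  ≡⟨ sym (fromℕ-+ (partialSum G t) (G t)) ⟩
  fromℕ (partialSum G (suc t))            ∎
  where
  open ≡-Reasoning
  g : Fin r → ℚ
  g = fromℕ ∘ G ∘ toℕ

-- Points and the linear inequalities of the cone

_⊕_ : Pt r → Pt r → Pt r
(a , b) ⊕ (c , d) = (λ i → a i ℚ.+ c i) , (λ i → b i ℚ.+ d i)

≈-sym : {x y : Pt r} → x ≈ y → y ≈ x
≈-sym (x₁≗y₁ , x₂≗y₂) = sym ∘ x₁≗y₁ , sym ∘ x₂≗y₂

≈-trans : {x y z : Pt r} → x ≈ y → y ≈ z → x ≈ z
≈-trans (x₁≗y₁ , x₂≗y₂) (y₁≗z₁ , y₂≗z₂) = (λ i → trans (x₁≗y₁ i) (y₁≗z₁ i)) , (λ i → trans (x₂≗y₂ i) (y₂≗z₂ i))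

⊕-congˡ : (z : Pt r) {x y : Pt r} → x ≈ y → (z ⊕ x) ≈ (z ⊕ y)
⊕-congˡ z (x₁≗y₁ , x₂≗y₂) = (λ i → cong (proj₁ z i ℚ.+_) (x₁≗y₁ i)) , (λ i → cong (proj₂ z i ℚ.+_) (x₂≗y₂ i))

scale-zero : (u : Pt r) → scale 0ℚ u ≈ zeroPt
scale-zero (a , b) = ℚₚ.*-zeroˡ ∘ a , ℚₚ.*-zeroˡ ∘ b

scale-one : (u : Pt r) → scale 1ℚ u ≈ u
scale-one (a , b) = ℚₚ.*-identityˡ ∘ a , ℚₚ.*-identityˡ ∘ b

scale-+ : ∀ s t (u : Pt r) → (scale s u ⊕ scale t u) ≈ scale (s ℚ.+ t) u
scale-+ s t (a , b) = (λ i → sym (ℚₚ.*-distribʳ-+ (a i) s t)) , (λ i → sym (ℚₚ.*-distribʳ-+ (b i) s t))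

dot-congʳ : (w : Pt r) {x y : Pt r} → x ≈ y → dot w x ≡ dot w y
dot-congʳ w (x₁≗y₁ , x₂≗y₂) =
  cong₂ ℚ._+_ (sumᶠ-cong (cong (proj₁ w _ ℚ.*_) ∘ x₁≗y₁)) (sumᶠ-cong (cong (proj₂ w _ ℚ.*_) ∘ x₂≗y₂))

dot-⊕ʳ : (w x y : Pt r) → dot w (x ⊕ y) ≡ dot w x ℚ.+ dot w y
dot-⊕ʳ (a , b) (c , d) (e , f) = trans
  (cong₂ ℚ._+_ (sumᶠ-cong (λ i → ℚₚ.*-distribˡ-+ (a i) (c i) (e i)))
               (sumᶠ-cong (λ i → ℚₚ.*-distribˡ-+ (b i) (d i) (f i))))
  (sumᶠ-+-interchange (λ i → a i ℚ.* c i) (λ i → a i ℚ.* e i) (λ i → b i ℚ.* d i) (λ i → b i ℚ.* f i))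

dot-⊕ˡ : (v w x : Pt r) → dot (v ⊕ w) x ≡ dot v x ℚ.+ dot w x
dot-⊕ˡ (a , b) (c , d) (e , f) = trans
  (cong₂ ℚ._+_ (sumᶠ-cong (λ i → ℚₚ.*-distribʳ-+ (e i) (a i) (c i)))
               (sumᶠ-cong (λ i → ℚₚ.*-distribʳ-+ (f i) (b i) (d i))))
  (sumᶠ-+-interchange (λ i → a i ℚ.* e i) (λ i → c i ℚ.* e i) (λ i → b i ℚ.* f i) (λ i → d i ℚ.* f i))

dot-scaleʳ : (w : Pt r) (s : ℚ) (x : Pt r) → dot w (scale s x) ≡ s ℚ.* dot w x
dot-scaleʳ (a , b) s (c , d) = trans
  (cong₂ ℚ._+_ (trans (sumᶠ-cong (λ i → *-swap (a i) (c i))) (sumᶠ-* s (λ i → a i ℚ.* c i)))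
               (trans (sumᶠ-cong (λ i → *-swap (b i) (d i))) (sumᶠ-* s (λ i → b i ℚ.* d i))))
  (sym (ℚₚ.*-distribˡ-+ s _ _))
  where
  *-swap : ∀ u v → u ℚ.* (s ℚ.* v) ≡ s ℚ.* (u ℚ.* v)
  *-swap u v = solveℚ 3 (λ s u v → u :* (s :* v) := s :* (u :* v)) refl s u v

dot-⊕-scale : (w : Pt r) (s : ℚ) (x y : Pt r) → dot w (scale s x ⊕ y) ≡ s ℚ.* dot w x ℚ.+ dot w y
dot-⊕-scale w s x y = trans (dot-⊕ʳ w (scale s x) y) (cong (ℚ._+ dot w y) (dot-scaleʳ w s x))

dot-zeroPtˡ : (x : Pt r) → dot zeroPt x ≡ 0ℚ
dot-zeroPtˡ (c , d) = trans (cong₂ ℚ._+_ (sumᶠ-zeroˡ c) (sumᶠ-zeroˡ d)) (ℚₚ.+-identityʳ 0ℚ)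

dot-zeroPtʳ : (w : Pt r) → dot w zeroPt ≡ 0ℚ
dot-zeroPtʳ (a , b) = trans (cong₂ ℚ._+_ (sumᶠ-zeroʳ a) (sumᶠ-zeroʳ b)) (ℚₚ.+-identityʳ 0ℚ)

unit : ℕ → Fin r → ℚ
unit k i = if toℕ i ≡ᵇ k then 1ℚ else 0ℚ

prefix : ℕ → Fin r → ℚ
prefix t i = if toℕ i <ᵇ t then 1ℚ else 0ℚ

data Constraint : Set where
  λ-drop μ-drop dominance : ℕ → Constraint

normal : Constraint → Pt r
normal (λ-drop k)    = (λ i → unit k i ℚ.- unit (suc k) i) , (λ _ → 0ℚ)
normal (μ-drop k)    = (λ _ → 0ℚ) , (λ i → unit k i ℚ.- unit (suc k) i)
normal (dominance t) = prefix t , (λ i → ℚ.- prefix t i)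

eval : Constraint → Pt r → ℚ
eval c x = dot (normal c) x

sumᶠ-unit : ∀ k (f : Fin r → ℚ) → sumᶠ (λ i → unit k i ℚ.* f i) ≡ at f k
sumᶠ-unit {zero}  k       f = refl
sumᶠ-unit {suc r} zero    f = begin
  1ℚ ℚ.* f Fin.zero ℚ.+ sumᶠ (λ i → 0ℚ ℚ.* f (Fin.suc i))
    ≡⟨ cong₂ ℚ._+_ (ℚₚ.*-identityˡ (f Fin.zero)) (sumᶠ-zeroˡ (f ∘ Fin.suc)) ⟩
  f Fin.zero ℚ.+ 0ℚ
    ≡⟨ ℚₚ.+-identityʳ (f Fin.zero) ⟩
  f Fin.zero ∎
  where open ≡-Reasoning
sumᶠ-unit {suc r} (suc k) f =
  trans (cong₂ ℚ._+_ (ℚₚ.*-zeroˡ (f Fin.zero)) (sumᶠ-unit k (f ∘ Fin.suc))) (ℚₚ.+-identityˡ _)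

sumᶠ-unit-drop : ∀ k (f : Fin r → ℚ) →
                 sumᶠ (λ i → (unit k i ℚ.- unit (suc k) i) ℚ.* f i) ≡ at f k ℚ.- at f (suc k)
sumᶠ-unit-drop {r} k f = begin
  sumᶠ (λ i → (unit k i ℚ.- unit (suc k) i) ℚ.* f i)
    ≡⟨ sumᶠ-cong (λ i → distrib (unit k i) (unit (suc k) i) (f i)) ⟩
  sumᶠ (λ i → unit k i ℚ.* f i ℚ.+ ℚ.- (unit (suc k) i ℚ.* f i))
    ≡⟨ sumᶠ-+ (λ i → unit k i ℚ.* f i) (λ i → ℚ.- (unit (suc k) i ℚ.* f i)) ⟩
  sumᶠ (λ i → unit k i ℚ.* f i) ℚ.+ sumᶠ (λ i → ℚ.- (unit (suc k) i ℚ.* f i))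
    ≡⟨ cong₂ ℚ._+_ (sumᶠ-unit k f)
         (trans (sumᶠ-neg (λ i → unit (suc k) i ℚ.* f i)) (cong ℚ.-_ (sumᶠ-unit (suc k) f))) ⟩
  at f k ℚ.- at f (suc k) ∎
  where
  open ≡-Reasoning
  distrib : ∀ u v w → (u ℚ.- v) ℚ.* w ≡ u ℚ.* w ℚ.+ ℚ.- (v ℚ.* w)
  distrib = solveℚ 3 (λ u v w → (u :- v) :* w := u :* w :+ :- (v :* w)) refl

sumᶠ-prefix : ∀ t (f : Fin r → ℚ) → sumᶠ (λ i → prefix t i ℚ.* f i) ≡ psum t f
sumᶠ-prefix t f = sumᶠ-cong (λ i → select (toℕ i <ᵇ t) (f i))
  where
  select : ∀ b x → (if b then 1ℚ else 0ℚ) ℚ.* x ≡ (if b then x else 0ℚ)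
  select true  x = ℚₚ.*-identityˡ x
  select false x = ℚₚ.*-zeroˡ x

eval-λ-drop : ∀ k (l m : Fin r → ℚ) → eval (λ-drop k) (l , m) ≡ at l k ℚ.- at l (suc k)
eval-λ-drop k l m = trans (cong₂ ℚ._+_ (sumᶠ-unit-drop k l) (sumᶠ-zeroˡ m)) (ℚₚ.+-identityʳ _)

eval-μ-drop : ∀ k (l m : Fin r → ℚ) → eval (μ-drop k) (l , m) ≡ at m k ℚ.- at m (suc k)
eval-μ-drop k l m = trans (cong₂ ℚ._+_ (sumᶠ-zeroˡ l) (sumᶠ-unit-drop k m)) (ℚₚ.+-identityˡ _)

eval-dominance : ∀ t (l m : Fin r → ℚ) → eval (dominance t) (l , m) ≡ psum t l ℚ.- psum t m
eval-dominance t l m = cong₂ ℚ._+_ (sumᶠ-prefix t l) (begin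
  sumᶠ (λ i → ℚ.- prefix t i ℚ.* m i)   ≡⟨ sumᶠ-cong (λ i → sym (ℚₚ.neg-distribˡ-* (prefix t i) (m i))) ⟩
  sumᶠ (λ i → ℚ.- (prefix t i ℚ.* m i)) ≡⟨ sumᶠ-neg (λ i → prefix t i ℚ.* m i) ⟩
  ℚ.- sumᶠ (λ i → prefix t i ℚ.* m i)   ≡⟨ cong ℚ.-_ (sumᶠ-prefix t m) ⟩
  ℚ.- psum t m                          ∎)
  where open ≡-Reasoning

-- λ-drop (r-1) says λ_{r-1} ≥ 0, and dominance 0 is trivial.
constraints : ℕ → List Constraint
constraints r = map λ-drop (upTo r) ++ map μ-drop (upTo r) ++ map dominance (upTo r)

λ-drop∈ : k < r → λ-drop k ∈ constraints r
λ-drop∈ k<r = ∈-++⁺ˡ (∈-map⁺ λ-drop (∈-upTo⁺ k<r))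

μ-drop∈ : k < r → μ-drop k ∈ constraints r
μ-drop∈ {r = r} k<r = ∈-++⁺ʳ (map λ-drop (upTo r)) (∈-++⁺ˡ (∈-map⁺ μ-drop (∈-upTo⁺ k<r)))

dominance∈ : k < r → dominance k ∈ constraints r
dominance∈ {r = r} k<r =
  ∈-++⁺ʳ (map λ-drop (upTo r)) (∈-++⁺ʳ (map μ-drop (upTo r)) (∈-map⁺ dominance (∈-upTo⁺ k<r)))

constraints-ind : (P : Constraint → Set) →
                  (∀ {k} → k < r → P (λ-drop k)) → (∀ {k} → k < r → P (μ-drop k)) →
                  (∀ {k} → k < r → P (dominance k)) → ∀ {c} → c ∈ constraints r → P c
constraints-ind {r} P Pλ Pμ Pd c∈ with ∈-++⁻ (map λ-drop (upTo r)) c∈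
... | inj₁ c∈λ with ∈-map⁻ λ-drop c∈λ
...   | k , k∈ , refl = Pλ (∈-upTo⁻ k∈)
constraints-ind {r} P Pλ Pμ Pd c∈ | inj₂ c∈′ with ∈-++⁻ (map μ-drop (upTo r)) c∈′
... | inj₁ c∈μ with ∈-map⁻ μ-drop c∈μ
...   | k , k∈ , refl = Pμ (∈-upTo⁻ k∈)
constraints-ind {r} P Pλ Pμ Pd c∈ | inj₂ c∈′ | inj₂ c∈d with ∈-map⁻ dominance c∈d
...   | k , k∈ , refl = Pd (∈-upTo⁻ k∈)

InCone : Pt r → Set
InCone {r} x = (∀ c → c ∈ constraints r → 0ℚ ℚ.≤ eval c x) × eval (dominance r) x ≡ 0ℚ

Drops : (Fin r → ℚ) → Set
Drops l = ∀ k → at l (suc k) ℚ.≤ at l k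

Partition-tail : {l : Fin (suc r) → ℚ} → Partition l → Partition (l ∘ Fin.suc)
Partition-tail (mono , nonNeg) = (λ i j i≤j → mono (Fin.suc i) (Fin.suc j) (s≤s i≤j)) , nonNeg ∘ Fin.suc

Partition⇒Drops : {l : Fin r → ℚ} → Partition l → Drops l
Partition⇒Drops {zero}        _              k       = ℚₚ.≤-refl
Partition⇒Drops {suc zero}    (_ , nonNeg)   zero    = nonNeg Fin.zero
Partition⇒Drops {suc (suc r)} (mono , _)     zero    = mono Fin.zero (Fin.suc Fin.zero) z≤n
Partition⇒Drops {suc r}       P              (suc k) = Partition⇒Drops (Partition-tail P) k

Drops-antitone : (l : Fin r → ℚ) → Drops l → ∀ {i j} → i ≤ j → at l j ℚ.≤ at l i
Drops-antitone l drops {i} i≤j with ℕₚ.m≤n⇒∃[o]m+o≡n i≤j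
... | d , refl = go d
  where
  go : ∀ d → at l (i + d) ℚ.≤ at l i
  go zero    = ℚₚ.≤-reflexive (cong (at l) (ℕₚ.+-identityʳ i))
  go (suc d) = ℚₚ.≤-trans (ℚₚ.≤-reflexive (cong (at l) (ℕₚ.+-suc i d))) (ℚₚ.≤-trans (drops (i + d)) (go d))

Drops-nonNeg : (l : Fin r → ℚ) → Drops l → ∀ k → 0ℚ ℚ.≤ at l k
Drops-nonNeg {r} l drops k =
  subst (ℚ._≤ at l k) (at-≥ l (ℕₚ.m≤n+m r k)) (Drops-antitone l drops (ℕₚ.m≤m+n k r))

Drops⇒Partition : {l : Fin r → ℚ} → (∀ k → k < r → at l (suc k) ℚ.≤ at l k) → Partition l
Drops⇒Partition {r} {l} drops<r = mono , nonNeg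
  where
  drops : Drops l
  drops k with k ℕ.<? r
  ... | yes k<r = drops<r k k<r
  ... | no  k≮r = ℚₚ.≤-reflexive (trans (at-≥ l (ℕₚ.m≤n⇒m≤1+n (ℕₚ.≮⇒≥ k≮r))) (sym (at-≥ l (ℕₚ.≮⇒≥ k≮r))))
  mono : ∀ i j → toℕ i ≤ toℕ j → l j ℚ.≤ l i
  mono i j i≤j = subst₂ ℚ._≤_ (at-toℕ l j) (at-toℕ l i) (Drops-antitone l drops i≤j)
  nonNeg : ∀ i → 0ℚ ℚ.≤ l i
  nonNeg i = subst (0ℚ ℚ.≤_) (at-toℕ l i) (Drops-nonNeg l drops (toℕ i))

InKostka⇒InCone : (x : Pt r) → InKostka x → InCone x
InKostka⇒InCone {r} (l , m) (λ-partition , μ-partition , dominates , sums≡) = nonNeg , balanced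
  where
  nonNeg : ∀ c → c ∈ constraints r → 0ℚ ℚ.≤ eval c (l , m)
  nonNeg c = constraints-ind (λ c → 0ℚ ℚ.≤ eval c (l , m))
    (λ {k} _ → subst (0ℚ ℚ.≤_) (sym (eval-λ-drop k l m)) (p≤q⇒0≤q-p (Partition⇒Drops λ-partition k)))
    (λ {k} _ → subst (0ℚ ℚ.≤_) (sym (eval-μ-drop k l m)) (p≤q⇒0≤q-p (Partition⇒Drops μ-partition k)))
    dominance-nonNeg
    where
    dominance-nonNeg : ∀ {t} → t < r → 0ℚ ℚ.≤ eval (dominance t) (l , m)
    dominance-nonNeg {zero} _ =
      ℚₚ.≤-reflexive (sym (trans (eval-dominance 0 l m) (cong₂ ℚ._-_ (psum-zero l) (psum-zero m))))
    dominance-nonNeg {suc t} t<r = subst (0ℚ ℚ.≤_) (sym (eval-dominance (suc t) l m))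
      (p≤q⇒0≤q-p (dominates (suc t) (s≤s z≤n) (ℕₚ.∸-monoˡ-≤ 1 t<r)))
  balanced : eval (dominance r) (l , m) ≡ 0ℚ
  balanced = trans (eval-dominance r l m) (trans (cong (ℚ._- psum r m) sums≡) (ℚₚ.+-inverseʳ (psum r m)))

InCone⇒InKostka : (x : Pt r) → InCone x → InKostka x
InCone⇒InKostka {r} (l , m) (nonNeg , balanced) =
  Drops⇒Partition (λ k k<r → 0≤q-p⇒p≤q (subst (0ℚ ℚ.≤_) (eval-λ-drop k l m) (nonNeg _ (λ-drop∈ k<r)))) ,
  Drops⇒Partition (λ k k<r → 0≤q-p⇒p≤q (subst (0ℚ ℚ.≤_) (eval-μ-drop k l m) (nonNeg _ (μ-drop∈ k<r)))) ,
  dominates ,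
  p-q≡0⇒p≡q (trans (sym (eval-dominance r l m)) balanced)
  where
  dominates : ∀ t → 1 ≤ t → t ≤ r ∸ 1 → psum t m ℚ.≤ psum t l
  dominates t 1≤t t≤r-1 =
    0≤q-p⇒p≤q (subst (0ℚ ℚ.≤_) (eval-dominance t l m) (nonNeg _ (dominance∈ (below r 1≤t t≤r-1))))
    where
    below : ∀ r → 1 ≤ t → t ≤ r ∸ 1 → t < r
    below zero    1≤t t≤0 with () ← ℕₚ.≤-trans 1≤t t≤0
    below (suc r) _   t≤r = s≤s t≤r

-- Generators

indicator : ℕ → ℕ → ℕ
indicator zero    k       = 0
indicator (suc a) zero    = 1
indicator (suc a) (suc k) = indicator a k

indicator-≥ : ∀ a k → a ≤ k → indicator a k ≡ 0
indicator-≥ zero    k       _         = refl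
indicator-≥ (suc a) (suc k) (s≤s a≤k) = indicator-≥ a k a≤k

indicator-< : ∀ a k → k < a → indicator a k ≡ 1
indicator-< (suc a) zero    _         = refl
indicator-< (suc a) (suc k) (s≤s k<a) = indicator-< a k k<a

indicator-anti : ∀ a k → indicator a (suc k) ≤ indicator a k
indicator-anti zero          k       = z≤n
indicator-anti (suc zero)    zero    = z≤n
indicator-anti (suc (suc a)) zero    = s≤s z≤n
indicator-anti (suc a)       (suc k) = indicator-anti a k

partialSum-indicator : ∀ a t → partialSum (indicator a) t ≡ t ⊓ a
partialSum-indicator a zero = refl
partialSum-indicator a (suc t) with t ℕ.<? a
... | yes t<a = begin
  partialSum (indicator a) t + indicator a t  ≡⟨ cong₂ _+_ (partialSum-indicator a t) (indicator-< a t t<a) ⟩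
  t ⊓ a + 1                                   ≡⟨ cong (_+ 1) (ℕₚ.m≤n⇒m⊓n≡m (ℕₚ.<⇒≤ t<a)) ⟩
  t + 1                                       ≡⟨ ℕₚ.+-comm t 1 ⟩
  suc t                                       ≡⟨ sym (ℕₚ.m≤n⇒m⊓n≡m t<a) ⟩
  suc t ⊓ a                                   ∎
  where open ≡-Reasoning
... | no t≮a = begin
  partialSum (indicator a) t + indicator a t  ≡⟨ cong₂ _+_ (partialSum-indicator a t) (indicator-≥ a t a≤t) ⟩
  t ⊓ a + 0                                   ≡⟨ ℕₚ.+-identityʳ (t ⊓ a) ⟩
  t ⊓ a                                       ≡⟨ ℕₚ.m≥n⇒m⊓n≡n a≤t ⟩
  a                                           ≡⟨ sym (ℕₚ.m≥n⇒m⊓n≡n (ℕₚ.m≤n⇒m≤1+n a≤t)) ⟩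
  suc t ⊓ a                                   ∎
  where
  open ≡-Reasoning
  a≤t : a ≤ t
  a≤t = ℕₚ.≮⇒≥ t≮a

partialSum-linear : ∀ m n (F G : ℕ → ℕ) t →
                    partialSum (λ k → m * F k + n * G k) t ≡ m * partialSum F t + n * partialSum G t
partialSum-linear m n F G zero    = sym (cong₂ _+_ (ℕₚ.*-zeroʳ m) (ℕₚ.*-zeroʳ n))
partialSum-linear m n F G (suc t) = begin
  partialSum (λ k → m * F k + n * G k) t + (m * F t + n * G t)
    ≡⟨ cong (_+ (m * F t + n * G t)) (partialSum-linear m n F G t) ⟩
  m * partialSum F t + n * partialSum G t + (m * F t + n * G t)
    ≡⟨ regroup m n (partialSum F t) (partialSum G t) (F t) (G t) ⟩
  m * (partialSum F t + F t) + n * (partialSum G t + G t) ∎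
  where
  open ≡-Reasoning
  regroup : ∀ m n x y u v → m * x + n * y + (m * u + n * v) ≡ m * (x + u) + n * (y + v)
  regroup = solve-∀

partialSum-scale : ∀ m (F : ℕ → ℕ) t → partialSum (λ k → m * F k) t ≡ m * partialSum F t
partialSum-scale m F zero    = sym (ℕₚ.*-zeroʳ m)
partialSum-scale m F (suc t) =
  trans (cong (_+ m * F t) (partialSum-scale m F t)) (sym (ℕₚ.*-distribˡ-+ m (partialSum F t) (F t)))

m*n>0 : ∀ {m n} → 0 < m → 0 < n → 0 < m * n
m*n>0 {suc m} {suc n} _ _ = s≤s z≤n

m*n>0⇒n>0 : ∀ m {n} → 0 < m * n → 0 < n
m*n>0⇒n>0 m {zero}  m*0>0 = ⊥-elim (ℕₚ.n≮0 (subst (0 <_) (ℕₚ.*-zeroʳ m) m*0>0))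
m*n>0⇒n>0 m {suc n} _     = s≤s z≤n

m+n>0⇒m>0∨n>0 : ∀ m {n} → 0 < m + n → 0 < m ⊎ 0 < n
m+n>0⇒m>0∨n>0 zero    n>0 = inj₂ n>0
m+n>0⇒m>0∨n>0 (suc m) _   = inj₁ (s≤s z≤n)

m<m+n⇒n>0 : ∀ m {n} → m < m + n → 0 < n
m<m+n⇒n>0 m {n} m<m+n = ℕₚ.+-cancelˡ-< m 0 n (subst (_< m + n) (sym (ℕₚ.+-identityʳ m)) m<m+n)

≯0⇒≡0 : ¬ (0 < n) → n ≡ 0
≯0⇒≡0 n≯0 = ℕₚ.n≤0⇒n≡0 (ℕₚ.≮⇒≥ n≯0)

jump : ℕ → ℕ → ℕ
jump a k = indicator a k ∸ indicator a (suc k)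

jump-pos⇔ : ∀ a k → 0 < jump a k ⇔ suc k ≡ a
jump-pos⇔ a k = mk⇔ (to a k) (from a k)
  where
  to : ∀ a k → 0 < jump a k → suc k ≡ a
  to zero          k       ()
  to (suc zero)    zero    _   = refl
  to (suc (suc a)) zero    ()
  to (suc a)       (suc k) pos = cong suc (to a k pos)
  from : ∀ a k → suc k ≡ a → 0 < jump a k
  from _ zero    refl = s≤s z≤n
  from _ (suc k) refl = from (suc k) k refl

data Generator : Set where
  diagonal : ℕ → Generator
  triple   : ℕ → ℕ → ℕ → Generator

Valid : ℕ → Generator → Set
Valid r (diagonal a)   = 1 ≤ a × a ≤ r
Valid r (triple b a c) = b < a × a < c × c ≤ r

shapeλ shapeμ : Generator → ℕ → ℕ
shapeλ (diagonal a)   k = indicator a k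
shapeλ (triple b a c) k = (c ∸ b) * indicator a k
shapeμ (diagonal a)   k = indicator a k
shapeμ (triple b a c) k = (c ∸ a) * indicator b k + (a ∸ b) * indicator c k

sumλ sumμ : Generator → ℕ → ℕ
sumλ g = partialSum (shapeλ g)
sumμ g = partialSum (shapeμ g)

value : Constraint → Generator → ℕ
value (λ-drop k)    g = shapeλ g k ∸ shapeλ g (suc k)
value (μ-drop k)    g = shapeμ g k ∸ shapeμ g (suc k)
value (dominance t) g = sumλ g t ∸ sumμ g t

apex : Generator → ℕ
apex (diagonal a)   = a
apex (triple b a c) = a

apex-pos : ∀ g → Valid r g → 0 < apex g
apex-pos (diagonal a)   (1≤a , _) = 1≤a
apex-pos (triple b a c) (b<a , _) = ℕₚ.≤-<-trans z≤n b<a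

apex-≤ : ∀ g → Valid r g → apex g ≤ r
apex-≤ (diagonal a)   (_ , a≤r)       = a≤r
apex-≤ (triple b a c) (_ , a<c , c≤r) = ℕₚ.≤-trans (ℕₚ.<⇒≤ a<c) c≤r

shapeλ-anti : ∀ g k → shapeλ g (suc k) ≤ shapeλ g k
shapeλ-anti (diagonal a)   k = indicator-anti a k
shapeλ-anti (triple b a c) k = ℕₚ.*-monoʳ-≤ (c ∸ b) (indicator-anti a k)

shapeμ-anti : ∀ g k → shapeμ g (suc k) ≤ shapeμ g k
shapeμ-anti (diagonal a)   k = indicator-anti a k
shapeμ-anti (triple b a c) k =
  ℕₚ.+-mono-≤ (ℕₚ.*-monoʳ-≤ (c ∸ a) (indicator-anti b k)) (ℕₚ.*-monoʳ-≤ (a ∸ b) (indicator-anti c k))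

shapeλ-≥ : ∀ g → Valid r g → r ≤ k → shapeλ g k ≡ 0
shapeλ-≥ (diagonal a)   (_ , a≤r)       r≤k = indicator-≥ a _ (ℕₚ.≤-trans a≤r r≤k)
shapeλ-≥ (triple b a c) (_ , a<c , c≤r) r≤k =
  trans (cong ((c ∸ b) *_) (indicator-≥ a _ (ℕₚ.≤-trans (ℕₚ.<⇒≤ a<c) (ℕₚ.≤-trans c≤r r≤k))))
        (ℕₚ.*-zeroʳ (c ∸ b))

shapeμ-≥ : ∀ g → Valid r g → r ≤ k → shapeμ g k ≡ 0
shapeμ-≥         (diagonal a)   (_ , a≤r)         r≤k = indicator-≥ a _ (ℕₚ.≤-trans a≤r r≤k)
shapeμ-≥ {k = k} (triple b a c) (b<a , a<c , c≤r) r≤k = begin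
  (c ∸ a) * indicator b k + (a ∸ b) * indicator c k
    ≡⟨ cong₂ (λ u v → (c ∸ a) * u + (a ∸ b) * v)
         (indicator-≥ b k (ℕₚ.≤-trans (ℕₚ.<⇒≤ (ℕₚ.<-trans b<a a<c)) c≤k)) (indicator-≥ c k c≤k) ⟩
  (c ∸ a) * 0 + (a ∸ b) * 0
    ≡⟨ cong₂ _+_ (ℕₚ.*-zeroʳ (c ∸ a)) (ℕₚ.*-zeroʳ (a ∸ b)) ⟩
  0 ∎
  where
  open ≡-Reasoning
  c≤k : c ≤ k
  c≤k = ℕₚ.≤-trans c≤r r≤k

λ-drop-pos⇔ : ∀ g → Valid r g → 0 < value (λ-drop k) g ⇔ suc k ≡ apex g
λ-drop-pos⇔         (diagonal a)   _               = jump-pos⇔ a _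
λ-drop-pos⇔ {k = k} (triple b a c) (b<a , a<c , _) = mk⇔
  (λ pos → Equivalence.to (jump-pos⇔ a k) (m*n>0⇒n>0 (c ∸ b) (subst (0 <_) value≡ pos)))
  (λ hit → subst (0 <_) (sym value≡)
             (m*n>0 (ℕₚ.m<n⇒0<n∸m (ℕₚ.<-trans b<a a<c)) (Equivalence.from (jump-pos⇔ a k) hit)))
  where
  value≡ : value (λ-drop k) (triple b a c) ≡ (c ∸ b) * jump a k
  value≡ = sym (ℕₚ.*-distribˡ-∸ (c ∸ b) (indicator a k) (indicator a (suc k)))

linear-∸ : ∀ m n {x x′ y y′} → x′ ≤ x → y′ ≤ y →
           (m * x + n * y) ∸ (m * x′ + n * y′) ≡ m * (x ∸ x′) + n * (y ∸ y′)
linear-∸ m n {x′ = x′} {y′ = y′} x′≤x y′≤y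
  with d , refl ← ℕₚ.m≤n⇒∃[o]m+o≡n x′≤x | e , refl ← ℕₚ.m≤n⇒∃[o]m+o≡n y′≤y = begin
  (m * (x′ + d) + n * (y′ + e)) ∸ (m * x′ + n * y′)  ≡⟨ cong (_∸ (m * x′ + n * y′)) (expand m n x′ y′ d e) ⟩
  (m * x′ + n * y′) + (m * d + n * e) ∸ (m * x′ + n * y′)
                                                     ≡⟨ ℕₚ.m+n∸m≡n (m * x′ + n * y′) (m * d + n * e) ⟩
  m * d + n * e                                      ≡⟨ sym (cong₂ (λ u v → m * u + n * v)
                                                                 (ℕₚ.m+n∸m≡n x′ d) (ℕₚ.m+n∸m≡n y′ e)) ⟩
  m * (x′ + d ∸ x′) + n * (y′ + e ∸ y′)              ∎
  where
  open ≡-Reasoning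
  expand : ∀ m n x y d e → m * (x + d) + n * (y + e) ≡ (m * x + n * y) + (m * d + n * e)
  expand = solve-∀

μ-drop-triple : ∀ b a c k → value (μ-drop k) (triple b a c) ≡ (c ∸ a) * jump b k + (a ∸ b) * jump c k
μ-drop-triple b a c k = linear-∸ (c ∸ a) (a ∸ b) (indicator-anti b k) (indicator-anti c k)

μ-drop-pos⇔-triple : ∀ {b a c} → b < a → a < c → 0 < value (μ-drop k) (triple b a c) ⇔ (suc k ≡ b ⊎ suc k ≡ c)
μ-drop-pos⇔-triple {k} {b} {a} {c} b<a a<c = mk⇔ to from
  where
  to : 0 < value (μ-drop k) (triple b a c) → suc k ≡ b ⊎ suc k ≡ c
  to pos with m+n>0⇒m>0∨n>0 ((c ∸ a) * jump b k) (subst (0 <_) (μ-drop-triple b a c k) pos)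
  ... | inj₁ pos₁ = inj₁ (Equivalence.to (jump-pos⇔ b k) (m*n>0⇒n>0 (c ∸ a) pos₁))
  ... | inj₂ pos₂ = inj₂ (Equivalence.to (jump-pos⇔ c k) (m*n>0⇒n>0 (a ∸ b) pos₂))
  from : suc k ≡ b ⊎ suc k ≡ c → 0 < value (μ-drop k) (triple b a c)
  from hit = subst (0 <_) (sym (μ-drop-triple b a c k)) (summand-pos hit)
    where
    summand-pos : suc k ≡ b ⊎ suc k ≡ c → 0 < (c ∸ a) * jump b k + (a ∸ b) * jump c k
    summand-pos (inj₁ hit) = ℕₚ.<-≤-trans (m*n>0 (ℕₚ.m<n⇒0<n∸m a<c) (Equivalence.from (jump-pos⇔ b k) hit))
                                          (ℕₚ.m≤m+n _ _)
    summand-pos (inj₂ hit) = ℕₚ.<-≤-trans (m*n>0 (ℕₚ.m<n⇒0<n∸m b<a) (Equivalence.from (jump-pos⇔ c k) hit))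
                                          (ℕₚ.m≤n+m _ _)

-- sλ and sμ are the partial sums of the shapes of the triple generator (b, b + P, b + P + Q);
-- their difference is a piecewise linear tent that is positive exactly on (b, c).
module Ramps (b P Q : ℕ) where

  a c : ℕ
  a = b + P
  c = a + Q

  sλ sμ : ℕ → ℕ
  sλ t = (P + Q) * (t ⊓ a)
  sμ t = Q * (t ⊓ b) + P * (t ⊓ c)

  b≤a : b ≤ a
  b≤a = ℕₚ.m≤m+n b P

  a≤c : a ≤ c
  a≤c = ℕₚ.m≤m+n a Q

  flat-below : t ≤ b → sμ t ≡ sλ t
  flat-below {t} t≤b
    rewrite ℕₚ.m≤n⇒m⊓n≡m t≤b
          | ℕₚ.m≤n⇒m⊓n≡m (ℕₚ.≤-trans t≤b b≤a)
          | ℕₚ.m≤n⇒m⊓n≡m (ℕₚ.≤-trans t≤b (ℕₚ.≤-trans b≤a a≤c))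
    = identity P Q t
    where
    identity : ∀ P Q t → Q * t + P * t ≡ (P + Q) * t
    identity = solve-∀

  flat-above : c ≤ t → sμ t ≡ sλ t
  flat-above {t} c≤t
    rewrite ℕₚ.m≥n⇒m⊓n≡n (ℕₚ.≤-trans (ℕₚ.≤-trans b≤a a≤c) c≤t)
          | ℕₚ.m≥n⇒m⊓n≡n c≤t
          | ℕₚ.m≥n⇒m⊓n≡n (ℕₚ.≤-trans a≤c c≤t)
    = identity b P Q
    where
    identity : ∀ b P Q → Q * b + P * (b + P + Q) ≡ (P + Q) * (b + P)
    identity = solve-∀

  rising : 0 < Q → b < t → t ≤ a → sμ t < sλ t
  rising Q>0 b<t t≤a with d , refl ← ℕₚ.m≤n⇒∃[o]m+o≡n (ℕₚ.<⇒≤ b<t) =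
    subst (sμ (b + d) <_) (sym excess) (ℕₚ.m<m+n (sμ (b + d)) (m*n>0 Q>0 (m<m+n⇒n>0 b b<t)))
    where
    open ≡-Reasoning
    identity : ∀ P Q b d → (P + Q) * (b + d) ≡ Q * b + P * (b + d) + Q * d
    identity = solve-∀
    excess : sλ (b + d) ≡ sμ (b + d) + Q * d
    excess = begin
      (P + Q) * ((b + d) ⊓ a)                           ≡⟨ cong ((P + Q) *_) (ℕₚ.m≤n⇒m⊓n≡m t≤a) ⟩
      (P + Q) * (b + d)                                 ≡⟨ identity P Q b d ⟩
      Q * b + P * (b + d) + Q * d                       ≡⟨ cong₂ (λ u v → Q * u + P * v + Q * d)
                                                             (sym (ℕₚ.m≥n⇒m⊓n≡n (ℕₚ.m≤m+n b d)))
                                                             (sym (ℕₚ.m≤n⇒m⊓n≡m (ℕₚ.≤-trans t≤a a≤c))) ⟩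
      Q * ((b + d) ⊓ b) + P * ((b + d) ⊓ c) + Q * d     ∎

  falling : 0 < P → a ≤ t → t < c → sμ t < sλ t
  falling P>0 a≤t t<c with ℕₚ.m≤n⇒∃[o]m+o≡n a≤t
  ... | d , refl with ℕₚ.m≤n⇒∃[o]m+o≡n (ℕₚ.+-cancelˡ-< a d Q t<c)
  ...   | e , Q≡ =
    subst (sμ (a + d) <_) (sym excess) (ℕₚ.m<m+n (sμ (a + d)) (m*n>0 P>0 (s≤s z≤n)))
    where
    open ≡-Reasoning
    identity : ∀ P b d e → (P + (suc d + e)) * (b + P) ≡ (suc d + e) * b + P * (b + P + d) + P * suc e
    identity = solve-∀
    excess : sλ (a + d) ≡ sμ (a + d) + P * suc e
    excess = begin
      (P + Q) * ((a + d) ⊓ a)                           ≡⟨ cong ((P + Q) *_) (ℕₚ.m≥n⇒m⊓n≡n (ℕₚ.m≤m+n a d)) ⟩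
      (P + Q) * a                                       ≡⟨ cong (λ Q → (P + Q) * a) (sym Q≡) ⟩
      (P + (suc d + e)) * (b + P)                       ≡⟨ identity P b d e ⟩
      (suc d + e) * b + P * (a + d) + P * suc e         ≡⟨ cong₂ (λ u v → u * b + P * v + P * suc e) Q≡
                                                             (sym (ℕₚ.m≤n⇒m⊓n≡m (ℕₚ.<⇒≤ t<c))) ⟩
      Q * b + P * ((a + d) ⊓ c) + P * suc e             ≡⟨ cong (λ u → Q * u + P * ((a + d) ⊓ c) + P * suc e)
                                                             (sym (ℕₚ.m≥n⇒m⊓n≡n (ℕₚ.≤-trans b≤a (ℕₚ.m≤m+n a d)))) ⟩
      Q * ((a + d) ⊓ b) + P * ((a + d) ⊓ c) + P * suc e ∎

  trichotomy : 0 < P → 0 < Q → ∀ t → (sμ t ≡ sλ t × (t ≤ b ⊎ c ≤ t)) ⊎ (sμ t < sλ t × b < t × t < c)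
  trichotomy P>0 Q>0 t with t ℕ.≤? b
  ... | yes t≤b = inj₁ (flat-below t≤b , inj₁ t≤b)
  ... | no  t≰b with t ℕ.≤? a | c ℕ.≤? t
  ...   | yes t≤a | _       =
    inj₂ (rising Q>0 (ℕₚ.≰⇒> t≰b) t≤a , ℕₚ.≰⇒> t≰b , ℕₚ.≤-<-trans t≤a (ℕₚ.m<m+n a Q>0))
  ...   | no  t≰a | yes c≤t = inj₁ (flat-above c≤t , inj₂ c≤t)
  ...   | no  t≰a | no  c≰t = inj₂ (falling P>0 (ℕₚ.<⇒≤ (ℕₚ.≰⇒> t≰a)) (ℕₚ.≰⇒> c≰t) ,
                                    ℕₚ.≤-<-trans b≤a (ℕₚ.≰⇒> t≰a) , ℕₚ.≰⇒> c≰t)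

sumλ-triple : ∀ b a c t → sumλ (triple b a c) t ≡ (c ∸ b) * (t ⊓ a)
sumλ-triple b a c t =
  trans (partialSum-scale (c ∸ b) (indicator a) t) (cong ((c ∸ b) *_) (partialSum-indicator a t))

sumμ-triple : ∀ b a c t → sumμ (triple b a c) t ≡ (c ∸ a) * (t ⊓ b) + (a ∸ b) * (t ⊓ c)
sumμ-triple b a c t = trans (partialSum-linear (c ∸ a) (a ∸ b) (indicator b) (indicator c) t)
  (cong₂ (λ u v → (c ∸ a) * u + (a ∸ b) * v) (partialSum-indicator b t) (partialSum-indicator c t))

triple-trichotomy : ∀ {b a c} → b < a → a < c → ∀ t →
                    (sumμ (triple b a c) t ≡ sumλ (triple b a c) t × (t ≤ b ⊎ c ≤ t)) ⊎
                    (sumμ (triple b a c) t < sumλ (triple b a c) t × b < t × t < c)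
-- With a = b + P and c = b + P + Q, the rewrites turn c ∸ b, c ∸ a and a ∸ b into P + Q, Q and P.
triple-trichotomy {b} b<a a<c t
  with P , refl ← ℕₚ.m≤n⇒∃[o]m+o≡n (ℕₚ.<⇒≤ b<a) | Q , refl ← ℕₚ.m≤n⇒∃[o]m+o≡n (ℕₚ.<⇒≤ a<c)
  rewrite sumλ-triple b (b + P) (b + P + Q) t | sumμ-triple b (b + P) (b + P + Q) t
        | ℕₚ.+-assoc b P Q | ℕₚ.m+n∸m≡n b (P + Q) | sym (ℕₚ.+-assoc b P Q)
        | ℕₚ.m+n∸m≡n (b + P) Q | ℕₚ.m+n∸m≡n b P
  = Ramps.trichotomy b P Q (m<m+n⇒n>0 b b<a) (m<m+n⇒n>0 (b + P) a<c) t

sumμ≤sumλ : ∀ g → Valid r g → ∀ t → sumμ g t ≤ sumλ g t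
sumμ≤sumλ (diagonal a)   _               t = ℕₚ.≤-refl
sumμ≤sumλ (triple b a c) (b<a , a<c , _) t with triple-trichotomy b<a a<c t
... | inj₁ (sums≡ , _) = ℕₚ.≤-reflexive sums≡
... | inj₂ (sums< , _) = ℕₚ.<⇒≤ sums<

dominance-diagonal : ∀ a t → value (dominance t) (diagonal a) ≡ 0
dominance-diagonal a t = ℕₚ.n∸n≡0 (partialSum (indicator a) t)

dominance-pos⇔-triple : ∀ {b a c} → b < a → a < c → 0 < value (dominance t) (triple b a c) ⇔ (b < t × t < c)
dominance-pos⇔-triple {t} {b} {a} {c} b<a a<c = mk⇔ to from
  where
  to : 0 < value (dominance t) (triple b a c) → b < t × t < c
  to pos with triple-trichotomy b<a a<c t
  ... | inj₁ (sums≡ , _)     = ⊥-elim (ℕₚ.<-irrefl (sym (ℕₚ.m≤n⇒m∸n≡0 (ℕₚ.≤-reflexive (sym sums≡)))) pos)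
  ... | inj₂ (_ , b<t , t<c) = b<t , t<c
  from : b < t × t < c → 0 < value (dominance t) (triple b a c)
  from (b<t , t<c) with triple-trichotomy b<a a<c t
  ... | inj₁ (_ , inj₁ t≤b) = ⊥-elim (ℕₚ.<⇒≱ b<t t≤b)
  ... | inj₁ (_ , inj₂ c≤t) = ⊥-elim (ℕₚ.<⇒≱ t<c c≤t)
  ... | inj₂ (sums< , _)    = ℕₚ.m<n⇒0<n∸m sums<

dominance-balanced : ∀ g → Valid r g → value (dominance r) g ≡ 0
dominance-balanced {r} (diagonal a)   _                 = dominance-diagonal a r
dominance-balanced {r} (triple b a c) (b<a , a<c , c≤r) with triple-trichotomy b<a a<c r
... | inj₁ (sums≡ , _)   = ℕₚ.m≤n⇒m∸n≡0 (ℕₚ.≤-reflexive (sym sums≡))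
... | inj₂ (_ , _ , r<c) = ⊥-elim (ℕₚ.<⇒≱ r<c c≤r)

genλ genμ : Generator → Fin r → ℚ
genλ g = fromℕ ∘ shapeλ g ∘ toℕ
genμ g = fromℕ ∘ shapeμ g ∘ toℕ

gen : Generator → Pt r
gen g = genλ g , genμ g

drop-fromℕ : (shape : ℕ → ℕ) → (∀ {k} → r ≤ k → shape k ≡ 0) → (∀ k → shape (suc k) ≤ shape k) →
             ∀ k → at {r} (fromℕ ∘ shape ∘ toℕ) k ℚ.- at {r} (fromℕ ∘ shape ∘ toℕ) (suc k) ≡
                   fromℕ (shape k ∸ shape (suc k))
drop-fromℕ shape vanish anti k = trans (cong₂ ℚ._-_ (at-fromℕ shape vanish k) (at-fromℕ shape vanish (suc k)))
                                       (sym (fromℕ-∸ (anti k)))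

eval-gen : ∀ g → Valid r g → ∀ c → eval c (gen {r} g) ≡ fromℕ (value c g)
eval-gen {r} g valid (λ-drop k) =
  trans (eval-λ-drop {r} k (genλ g) (genμ g)) (drop-fromℕ {r} (shapeλ g) (shapeλ-≥ g valid) (shapeλ-anti g) k)
eval-gen {r} g valid (μ-drop k) =
  trans (eval-μ-drop {r} k (genλ g) (genμ g)) (drop-fromℕ {r} (shapeμ g) (shapeμ-≥ g valid) (shapeμ-anti g) k)
eval-gen {r} g valid (dominance t) = begin
  eval (dominance t) (gen {r} g)               ≡⟨ eval-dominance {r} t (genλ g) (genμ g) ⟩
  psum t (genλ {r} g) ℚ.- psum t (genμ {r} g)  ≡⟨ cong₂ ℚ._-_ (psum-fromℕ (shapeλ g) (shapeλ-≥ g valid) t)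
                                                              (psum-fromℕ (shapeμ g) (shapeμ-≥ g valid) t) ⟩
  fromℕ (sumλ g t) ℚ.- fromℕ (sumμ g t)        ≡⟨ sym (fromℕ-∸ (sumμ≤sumλ g valid t)) ⟩
  fromℕ (value (dominance t) g)                ∎
  where open ≡-Reasoning

gen-InCone : ∀ g → Valid r g → InCone (gen {r} g)
gen-InCone {r} g valid =
  (λ c _ → subst (0ℚ ℚ.≤_) (sym (eval-gen g valid c)) (fromℕ-nonNeg (value c g))) ,
  trans (eval-gen g valid (dominance r)) (cong fromℕ (dominance-balanced g valid))

apexDrop : Generator → Constraint
apexDrop g = λ-drop (pred (apex g))

suc-pred-apex : ∀ g → Valid r g → suc (pred (apex g)) ≡ apex g
suc-pred-apex g valid = ℕₚ.suc-pred (apex g) {{ℕ.>-nonZero (apex-pos g valid)}}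

apexDrop∈ : ∀ g → Valid r g → apexDrop g ∈ constraints r
apexDrop∈ g valid = λ-drop∈ (subst (_≤ _) (sym (suc-pred-apex g valid)) (apex-≤ g valid))

apexDrop-pos : ∀ g → Valid r g → 0 < value (apexDrop g) g
apexDrop-pos g valid = Equivalence.from (λ-drop-pos⇔ g valid) (suc-pred-apex g valid)

Separates : ℕ → Generator → Generator → Set
Separates r g h = ∃ λ c → c ∈ constraints r × value c g ≡ 0 × 0 < value c h

separate-apexes : ∀ g h → Valid r g → Valid r h → apex g ≢ apex h → Separates r g h
separate-apexes g h valid-g valid-h apex≢ =
  apexDrop h , apexDrop∈ h valid-h ,
  ≯0⇒≡0 (λ pos → apex≢ (trans (sym (Equivalence.to (λ-drop-pos⇔ g valid-g) pos)) (suc-pred-apex h valid-h))) ,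
  apexDrop-pos h valid-h

separate-tops : ∀ {b a c c′} → b < a → a < c → a < c′ → c′ ≤ r → c ≢ c′ →
                Separates r (triple b a c) (triple b a c′)
separate-tops {c′ = suc k} b<a a<c a<c′ c′≤r c≢c′ =
  μ-drop k , μ-drop∈ c′≤r ,
  ≯0⇒≡0 (λ pos → [ (λ k+1≡b → ℕₚ.<-irrefl (sym k+1≡b) (ℕₚ.<-trans b<a a<c′)) , (λ k+1≡c → c≢c′ (sym k+1≡c)) ]′
                     (Equivalence.to (μ-drop-pos⇔-triple b<a a<c) pos)) ,
  Equivalence.from (μ-drop-pos⇔-triple b<a a<c′) (inj₂ refl)

separate-bottoms : ∀ {b b′ a c c′} → b < a → a < c → b′ < a → a < c′ → c′ ≤ r → b ≢ b′ →
                   Separates r (triple b a c) (triple b′ a c′)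
separate-bottoms {b′ = zero} {c′ = c′} b<a a<c b′<a a<c′ c′≤r b≢0 =
  dominance 1 , dominance∈ (ℕₚ.<-≤-trans 1<c′ c′≤r) ,
  ≯0⇒≡0 (λ pos → b≢0 (ℕₚ.n<1⇒n≡0 (proj₁ (Equivalence.to (dominance-pos⇔-triple b<a a<c) pos)))) ,
  Equivalence.from (dominance-pos⇔-triple b′<a a<c′) (s≤s z≤n , 1<c′)
  where
  1<c′ : 1 < c′
  1<c′ = ℕₚ.≤-<-trans b′<a a<c′
separate-bottoms {b′ = suc k} b<a a<c b′<a a<c′ c′≤r b≢b′ =
  μ-drop k , μ-drop∈ (ℕₚ.<⇒≤ (ℕₚ.<-≤-trans (ℕₚ.<-trans b′<a a<c′) c′≤r)) ,
  ≯0⇒≡0 (λ pos → [ (λ k+1≡b → b≢b′ (sym k+1≡b)) , (λ k+1≡c → ℕₚ.<-irrefl k+1≡c (ℕₚ.<-trans b′<a a<c)) ]′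
                     (Equivalence.to (μ-drop-pos⇔-triple b<a a<c) pos)) ,
  Equivalence.from (μ-drop-pos⇔-triple b′<a a<c′) (inj₁ refl)

separate-same-apex : ∀ g h → Valid r g → Valid r h → g ≢ h → apex g ≡ apex h → Separates r g h
separate-same-apex (diagonal a) (diagonal .a) _ _ g≢h refl = ⊥-elim (g≢h refl)
separate-same-apex (diagonal a) (triple b′ .a c′) _ (b′<a , a<c′ , c′≤r) _ refl =
  dominance a , dominance∈ (ℕₚ.<-≤-trans a<c′ c′≤r) , dominance-diagonal a a ,
  Equivalence.from (dominance-pos⇔-triple b′<a a<c′) (b′<a , a<c′)
separate-same-apex (triple b (suc k) c) (diagonal .(suc k)) (b<a , a<c , _) (_ , a≤r) _ refl =
  μ-drop k , μ-drop∈ a≤r ,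
  ≯0⇒≡0 (λ pos → [ (λ k+1≡b → ℕₚ.<-irrefl (sym k+1≡b) b<a) , (λ k+1≡c → ℕₚ.<-irrefl k+1≡c a<c) ]′
                     (Equivalence.to (μ-drop-pos⇔-triple b<a a<c) pos)) ,
  Equivalence.from (jump-pos⇔ (suc k) k) refl
separate-same-apex (triple b a c) (triple b′ .a c′) (b<a , a<c , _) (b′<a , a<c′ , c′≤r) g≢h refl
  with b ℕ.≟ b′ | c ℕ.≟ c′
... | yes refl | yes refl = ⊥-elim (g≢h refl)
... | yes refl | no  c≢c′ = separate-tops b<a a<c a<c′ c′≤r c≢c′
... | no  b≢b′ | _        = separate-bottoms b<a a<c b′<a a<c′ c′≤r b≢b′

separate : ∀ g h → Valid r g → Valid r h → g ≢ h → Separates r g h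
separate g h valid-g valid-h g≢h with apex g ℕ.≟ apex h
... | yes apex≡ = separate-same-apex g h valid-g valid-h g≢h apex≡
... | no  apex≢ = separate-apexes g h valid-g valid-h apex≢

-- Supporting generators

crossing : (P : ℕ → Set) → (∀ n → Dec (P n)) → ¬ P 0 → ∀ n → P n → ∃ λ k → ¬ P k × P (suc k)
crossing P P? ¬P0 zero    P0   = ⊥-elim (¬P0 P0)
crossing P P? ¬P0 (suc n) Pn+1 with P? n
... | yes Pn = crossing P P? ¬P0 n Pn
... | no ¬Pn = n , ¬Pn , Pn+1

last-below : (P : ℕ → Set) → (∀ n → Dec (P n)) → P 0 → ∀ k →
             ∃ λ b → b ≤ k × P b × (∀ t → b < t → t ≤ k → ¬ P t)
last-below P P? P0 zero = 0 , z≤n , P0 , λ t 0<t t≤0 → ⊥-elim (ℕₚ.<⇒≱ 0<t t≤0)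
last-below P P? P0 (suc k) with P? (suc k)
... | yes Pk+1 = suc k , ℕₚ.≤-refl , Pk+1 , λ t k+1<t t≤k+1 → ⊥-elim (ℕₚ.<⇒≱ k+1<t t≤k+1)
... | no ¬Pk+1 with last-below P P? P0 k
...   | b , b≤k , Pb , none = b , ℕₚ.m≤n⇒m≤1+n b≤k , Pb , none′
  where
  none′ : ∀ t → b < t → t ≤ suc k → ¬ P t
  none′ t b<t t≤k+1 with t ℕ.≟ suc k
  ... | yes refl  = ¬Pk+1
  ... | no  t≢k+1 = none t b<t (ℕₚ.≤-pred (ℕₚ.≤∧≢⇒< t≤k+1 t≢k+1))

SupportedBy : Generator → Pt r → Set
SupportedBy g x = ∀ c → 0 < value c g → 0ℚ ℚ.< eval c x

module Support {r : ℕ} (l m : Fin r → ℚ) (x∈ : InCone (l , m)) where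

  λ-drops : Drops l
  λ-drops = Partition⇒Drops (proj₁ (InCone⇒InKostka (l , m) x∈))

  μ-drops : Drops m
  μ-drops = Partition⇒Drops (proj₁ (proj₂ (InCone⇒InKostka (l , m) x∈)))

  μ-antitone : ∀ {i j} → i ≤ j → at m j ℚ.≤ at m i
  μ-antitone = Drops-antitone m μ-drops

  D : ℕ → ℚ
  D t = psum t l ℚ.- psum t m

  D-eval : ∀ t → eval (dominance t) (l , m) ≡ D t
  D-eval t = eval-dominance t l m

  D-suc : ∀ t → D (suc t) ≡ D t ℚ.+ (at l t ℚ.- at m t)
  D-suc t = trans (cong₂ ℚ._-_ (psum-suc l t) (psum-suc m t)) (regroup (psum t l) (at l t) (psum t m) (at m t))
    where
    regroup : ∀ a b c d → (a ℚ.+ b) ℚ.- (c ℚ.+ d) ≡ (a ℚ.- c) ℚ.+ (b ℚ.- d)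
    regroup = solveℚ 4 (λ a b c d → (a :+ b) :- (c :+ d) := (a :- c) :+ (b :- d)) refl

  D-zero : D 0 ≡ 0ℚ
  D-zero = cong₂ ℚ._-_ (psum-zero l) (psum-zero m)

  D-≥ : r ≤ t → D t ≡ 0ℚ
  D-≥ r≤t = trans (cong₂ ℚ._-_ (psum-≥ l r≤t) (psum-≥ m r≤t)) (trans (sym (D-eval r)) (proj₂ x∈))

  D-nonNeg : ∀ t → 0ℚ ℚ.≤ D t
  D-nonNeg t with t ℕ.<? r
  ... | yes t<r = subst (0ℚ ℚ.≤_) (D-eval t) (proj₁ x∈ (dominance t) (dominance∈ t<r))
  ... | no  t≮r = ℚₚ.≤-reflexive (sym (D-≥ (ℕₚ.≮⇒≥ t≮r)))

  rise≡ : ∀ t → D (suc t) ℚ.- D t ≡ at l t ℚ.- at m t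
  rise≡ t = trans (cong (ℚ._- D t) (D-suc t))
    (solveℚ 2 (λ d e → (d :+ e) :- d := e) refl (D t) (at l t ℚ.- at m t))

  fall≡ : ∀ t → D t ℚ.- D (suc t) ≡ at m t ℚ.- at l t
  fall≡ t = trans (cong (λ d → D t ℚ.- d) (D-suc t))
    (solveℚ 3 (λ d a b → d :- (d :+ (a :- b)) := b :- a) refl (D t) (at l t) (at m t))

  rises⇒μ≤λ : D t ℚ.≤ D (suc t) → at m t ℚ.≤ at l t
  rises⇒μ≤λ {t} rises = 0≤q-p⇒p≤q (subst (0ℚ ℚ.≤_) (rise≡ t) (p≤q⇒0≤q-p rises))

  rises⇒μ<λ : D t ℚ.< D (suc t) → at m t ℚ.< at l t
  rises⇒μ<λ {t} rises = 0<q-p⇒p<q (subst (0ℚ ℚ.<_) (rise≡ t) (p<q⇒0<q-p rises))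

  falls⇒λ≤μ : D (suc t) ℚ.≤ D t → at l t ℚ.≤ at m t
  falls⇒λ≤μ {t} falls = 0≤q-p⇒p≤q (subst (0ℚ ℚ.≤_) (fall≡ t) (p≤q⇒0≤q-p falls))

  -- Once μ has ended, D can only grow, and it ends at 0.
  D-≤0 : ∀ k → (∀ t → k ≤ t → at m t ≡ 0ℚ) → k ≤ t → D t ℚ.≤ 0ℚ
  D-≤0 {t} k μ-vanishes k≤t = ℚₚ.≤-trans (growing r) (ℚₚ.≤-reflexive (D-≥ (ℕₚ.m≤n+m r t)))
    where
    rise : ∀ s → k ≤ s → D s ℚ.≤ D (suc s)
    rise s k≤s = 0≤q-p⇒p≤q (subst (0ℚ ℚ.≤_) (sym increment≡) (Drops-nonNeg l λ-drops s))
      where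
      increment≡ : D (suc s) ℚ.- D s ≡ at l s
      increment≡ = trans (rise≡ s)
        (trans (cong (λ μₛ → at l s ℚ.- μₛ) (μ-vanishes s k≤s)) (ℚₚ.+-identityʳ (at l s)))
    growing : ∀ d → D t ℚ.≤ D (t + d)
    growing zero    = ℚₚ.≤-reflexive (cong D (sym (ℕₚ.+-identityʳ t)))
    growing (suc d) = ℚₚ.≤-trans (growing d) (ℚₚ.≤-trans (rise (t + d) (ℕₚ.≤-trans k≤t (ℕₚ.m≤m+n t d)))
                                                          (ℚₚ.≤-reflexive (cong D (sym (ℕₚ.+-suc t d)))))

  zero-point : ¬ (0ℚ ℚ.< at m 0) → (l , m) ≈ zeroPt
  zero-point μ₀≯0 = (λ i → trans (sym (at-toℕ l i)) (λ-zero (toℕ i))) ,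
                    (λ i → trans (sym (at-toℕ m i)) (μ-zero (toℕ i) z≤n))
    where
    μ-zero : ∀ t → 0 ≤ t → at m t ≡ 0ℚ
    μ-zero t _ = ℚₚ.≤-antisym (ℚₚ.≤-trans (μ-antitone z≤n) (ℚₚ.≮⇒≥ μ₀≯0)) (Drops-nonNeg m μ-drops t)
    D-vanishes : ∀ t → D t ≡ 0ℚ
    D-vanishes t = ℚₚ.≤-antisym (D-≤0 {t} 0 μ-zero z≤n) (D-nonNeg t)
    λ-zero : ∀ t → at l t ≡ 0ℚ
    λ-zero t = ℚₚ.≤-antisym (subst (at l t ℚ.≤_) (μ-zero t z≤n) (falls⇒λ≤μ D-flat)) (Drops-nonNeg l λ-drops t)
      where
      D-flat : D (suc t) ℚ.≤ D t
      D-flat = ℚₚ.≤-reflexive (trans (D-vanishes (suc t)) (sym (D-vanishes t)))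

  -- k is the last index with μₖ > 0.  If b is the last t ≤ k with D t = 0, then x is supported by the
  -- diagonal generator 1^{k+1} when b = k, and otherwise by the triple (b, j+1, k+1) for some strict
  -- drop λ_{j+1} < λ_j with b ≤ j < k, which must exist as D would otherwise be positive at k+1.
  module Last (k : ℕ) (μₖ>0 : 0ℚ ℚ.< at m k) (μₖ₊₁≤0 : at m (suc k) ℚ.≤ 0ℚ) where

    μ-vanishes : ∀ t → suc k ≤ t → at m t ≡ 0ℚ
    μ-vanishes t k<t = ℚₚ.≤-antisym (ℚₚ.≤-trans (μ-antitone k<t) μₖ₊₁≤0) (Drops-nonNeg m μ-drops t)

    k<r : k < r
    k<r with k ℕ.<? r
    ... | yes k<r = k<r
    ... | no  k≮r = ⊥-elim (ℚₚ.<-irrefl (sym (at-≥ m (ℕₚ.≮⇒≥ k≮r))) μₖ>0)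

    μ-drop-k : 0ℚ ℚ.< eval (μ-drop k) (l , m)
    μ-drop-k = subst (0ℚ ℚ.<_) (sym (eval-μ-drop k l m)) (p<q⇒0<q-p (ℚₚ.≤-<-trans μₖ₊₁≤0 μₖ>0))

    D-beyond : suc k ≤ t → D t ℚ.≤ 0ℚ
    D-beyond = D-≤0 (suc k) μ-vanishes

    diagonal-supports : D k ≡ 0ℚ → SupportedBy (diagonal (suc k)) (l , m)
    diagonal-supports Dₖ≡0 (λ-drop j) pos with Equivalence.to (jump-pos⇔ (suc k) j) pos
    ... | refl = subst (0ℚ ℚ.<_) (sym (eval-λ-drop k l m)) (p<q⇒0<q-p λₖ₊₁<λₖ)
      where
      λₖ₊₁≤0 : at l (suc k) ℚ.≤ 0ℚ
      λₖ₊₁≤0 = subst (at l (suc k) ℚ.≤_) (μ-vanishes (suc k) ℕₚ.≤-refl)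
        (falls⇒λ≤μ (ℚₚ.≤-trans (D-beyond (ℕₚ.n≤1+n (suc k))) (D-nonNeg (suc k))))
      μₖ≤λₖ : at m k ℚ.≤ at l k
      μₖ≤λₖ = rises⇒μ≤λ (subst (ℚ._≤ D (suc k)) (sym Dₖ≡0) (D-nonNeg (suc k)))
      λₖ₊₁<λₖ : at l (suc k) ℚ.< at l k
      λₖ₊₁<λₖ = ℚₚ.≤-<-trans λₖ₊₁≤0 (ℚₚ.<-≤-trans μₖ>0 μₖ≤λₖ)
    diagonal-supports Dₖ≡0 (μ-drop j) pos with Equivalence.to (jump-pos⇔ (suc k) j) pos
    ... | refl = μ-drop-k
    diagonal-supports Dₖ≡0 (dominance t) pos = ⊥-elim (ℕₚ.<-irrefl (sym (dominance-diagonal (suc k) t)) pos)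

    LastZeroAt : ℕ → Set
    LastZeroAt b = b ≤ k × D b ≡ 0ℚ × (∀ t → b < t → t ≤ k → 0ℚ ℚ.< D t)

    μ<λ-after-last-zero : ∀ {b} → LastZeroAt b → b < k → at m b ℚ.< at l b
    μ<λ-after-last-zero {b} (_ , D-b , D-pos) b<k =
      rises⇒μ<λ (subst (ℚ._< D (suc b)) (sym D-b) (D-pos (suc b) (ℕₚ.n<1+n b) b<k))

    triple-supports : ∀ {b j} → LastZeroAt b → b ≤ j → j < k → at l (suc j) ℚ.< at l j →
                      SupportedBy (triple b (suc j) (suc k)) (l , m)
    triple-supports {b} {j} _ b≤j j<k λ-drop-j (λ-drop i) pos
      with Equivalence.to (λ-drop-pos⇔ (triple b (suc j) (suc k)) (s≤s b≤j , s≤s j<k , k<r)) pos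
    ... | refl = subst (0ℚ ℚ.<_) (sym (eval-λ-drop j l m)) (p<q⇒0<q-p λ-drop-j)
    triple-supports {b} {j} zero-at b≤j j<k _ (μ-drop i) pos
      with Equivalence.to (μ-drop-pos⇔-triple {b = b} (s≤s b≤j) (s≤s j<k)) pos
    ... | inj₂ refl = μ-drop-k
    ... | inj₁ refl = subst (0ℚ ℚ.<_) (sym (eval-μ-drop i l m))
                        (p<q⇒0<q-p (ℚₚ.<-≤-trans μ<λ-at-b (ℚₚ.≤-trans (λ-drops i) λᵢ≤μᵢ)))
      where
      μ<λ-at-b : at m (suc i) ℚ.< at l (suc i)
      μ<λ-at-b = μ<λ-after-last-zero zero-at (ℕₚ.≤-<-trans b≤j j<k)
      λᵢ≤μᵢ : at l i ℚ.≤ at m i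
      λᵢ≤μᵢ = falls⇒λ≤μ (subst (ℚ._≤ D i) (sym (proj₁ (proj₂ zero-at))) (D-nonNeg i))
    triple-supports {b} {j} (_ , _ , D-pos) b≤j j<k _ (dominance t) pos
      with Equivalence.to (dominance-pos⇔-triple {t = t} (s≤s b≤j) (s≤s j<k)) pos
    ... | b<t , t<k+1 = subst (0ℚ ℚ.<_) (sym (D-eval t)) (D-pos t b<t (ℕₚ.≤-pred t<k+1))

    λ-strictly-drops : ∀ {b} → LastZeroAt b → b < k → ∃ λ j → b ≤ j × j < k × at l (suc j) ℚ.< at l j
    λ-strictly-drops {b} zero-at@(b≤k , _ , D-pos) b<k
      with ℕₚ.anyUpTo? (λ d → at l (suc (b + d)) ℚₚ.<? at l (b + d)) (k ∸ b)
    ... | yes (d , d<k∸b , drop) =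
      b + d , ℕₚ.m≤m+n b d , subst (b + d <_) (ℕₚ.m+[n∸m]≡n b≤k) (ℕₚ.+-monoʳ-< b d<k∸b) , drop
    ... | no none = ⊥-elim (ℚₚ.<-irrefl refl (ℚₚ.<-≤-trans Dₖ₊₁>0 (D-beyond ℕₚ.≤-refl)))
      where
      flat : ∀ d → d ≤ k ∸ b → at l b ℚ.≤ at l (b + d)
      flat zero    _     = ℚₚ.≤-reflexive (cong (at l) (sym (ℕₚ.+-identityʳ b)))
      flat (suc d) d<k∸b = ℚₚ.≤-trans (flat d (ℕₚ.<⇒≤ d<k∸b))
        (ℚₚ.≤-trans (ℚₚ.≮⇒≥ (λ drop → none (d , d<k∸b , drop)))
                    (ℚₚ.≤-reflexive (cong (at l) (sym (ℕₚ.+-suc b d)))))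
      μₖ≤λₖ : at m k ℚ.≤ at l k
      μₖ≤λₖ = ℚₚ.≤-trans (μ-antitone b≤k) (ℚₚ.≤-trans (ℚₚ.<⇒≤ (μ<λ-after-last-zero zero-at b<k))
                (subst (λ t → at l b ℚ.≤ at l t) (ℕₚ.m+[n∸m]≡n b≤k) (flat (k ∸ b) ℕₚ.≤-refl)))
      Dₖ₊₁>0 : 0ℚ ℚ.< D (suc k)
      Dₖ₊₁>0 = subst (0ℚ ℚ.<_) (sym (D-suc k)) (+-posˡ (D-pos k b<k ℕₚ.≤-refl) (p≤q⇒0≤q-p μₖ≤λₖ))

    supported-from : ∀ b → LastZeroAt b → Σ Generator λ g → Valid r g × SupportedBy g (l , m)
    supported-from b zero-at@(b≤k , D-b , _) with b ℕ.≟ k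
    ... | yes refl = diagonal (suc k) , (s≤s z≤n , k<r) , diagonal-supports D-b
    ... | no  b≢k with λ-strictly-drops zero-at (ℕₚ.≤∧≢⇒< b≤k b≢k)
    ...   | j , b≤j , j<k , drop =
      triple b (suc j) (suc k) , (s≤s b≤j , s≤s j<k , k<r) , triple-supports zero-at b≤j j<k drop

    supporting-generator : Σ Generator λ g → Valid r g × SupportedBy g (l , m)
    supporting-generator with last-below (λ t → D t ≡ 0ℚ) (λ t → D t ℚₚ.≟ 0ℚ) D-zero k
    ... | b , b≤k , D-b , none =
      supported-from b (b≤k , D-b , λ t b<t t≤k → 0≤p∧p≢0⇒0<p (D-nonNeg t) (none t b<t t≤k))

  zero-or-supported : (l , m) ≈ zeroPt ⊎ Σ Generator λ g → Valid r g × SupportedBy g (l , m)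
  zero-or-supported with 0ℚ ℚₚ.<? at m 0
  ... | no  μ₀≯0 = inj₁ (zero-point μ₀≯0)
  ... | yes μ₀>0 with crossing (λ k → at m k ℚ.≤ 0ℚ) (λ k → at m k ℚₚ.≤? 0ℚ)
                               (λ μ₀≤0 → ℚₚ.<-irrefl refl (ℚₚ.<-≤-trans μ₀>0 μ₀≤0))
                               r (ℚₚ.≤-reflexive (at-≥ m ℕₚ.≤-refl))
  ...   | k , μₖ≰0 , μₖ₊₁≤0 = inj₂ (Last.supporting-generator k (ℚₚ.≰⇒> μₖ≰0) μₖ₊₁≤0)

-- Decomposition into generators

_÷ℕ_ : ℚ → ℕ → ℚ
p ÷ℕ zero    = 0ℚ
p ÷ℕ (suc n) = (p ℚ.÷ fromℕ (suc n)) {{ℚ.>-nonZero (fromℕ-pos {suc n} (s≤s z≤n))}}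

÷ℕ-*-cancel : ∀ p {n} → 0 < n → (p ÷ℕ n) ℚ.* fromℕ n ≡ p
÷ℕ-*-cancel p {suc n} _ = begin
  (p ℚ.* ℚ.1/ d) ℚ.* d   ≡⟨ ℚₚ.*-assoc p (ℚ.1/ d) d ⟩
  p ℚ.* (ℚ.1/ d ℚ.* d)   ≡⟨ cong (p ℚ.*_) (ℚₚ.*-inverseˡ d) ⟩
  p ℚ.* 1ℚ               ≡⟨ ℚₚ.*-identityʳ p ⟩
  p                      ∎
  where
  open ≡-Reasoning
  d : ℚ
  d = fromℕ (suc n)
  instance
    d≢0 : ℚ.NonZero d
    d≢0 = ℚ.>-nonZero (fromℕ-pos {suc n} (s≤s z≤n))

÷ℕ-pos : 0ℚ ℚ.< p → 0 < n → 0ℚ ℚ.< p ÷ℕ n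
÷ℕ-pos {p = p} {suc n} p>0 _ = *-pos p>0 (ℚₚ.positive⁻¹ _ {{ℚₚ.1/pos⇒pos d {{ℚ.positive d>0}}}})
  where
  d : ℚ
  d = fromℕ (suc n)
  d>0 : 0ℚ ℚ.< d
  d>0 = fromℕ-pos {suc n} (s≤s z≤n)

≤÷ℕ⇒*≤ : ∀ {θ} p n → 0 < n → θ ℚ.≤ p ÷ℕ n → θ ℚ.* fromℕ n ℚ.≤ p
≤÷ℕ⇒*≤ p n n>0 θ≤p/n =
  subst (_ ℚ.≤_) (÷ℕ-*-cancel p n>0) (ℚₚ.*-monoʳ-≤-nonNeg (fromℕ n) {{ℚ.nonNegative (fromℕ-nonNeg n)}} θ≤p/n)

strictCount : List Constraint → Pt r → ℕ
strictCount []       x = 0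
strictCount (c ∷ cs) x with 0ℚ ℚₚ.<? eval c x
... | yes _ = suc (strictCount cs x)
... | no  _ = strictCount cs x

StrictIn : List Constraint → Pt r → Pt r → Set
StrictIn cs y x = ∀ c → c ∈ cs → 0ℚ ℚ.< eval c y → 0ℚ ℚ.< eval c x

strictCount-mono : ∀ cs (x y : Pt r) → StrictIn cs y x → strictCount cs y ≤ strictCount cs x
strictCount-mono []       x y y⊆x = z≤n
strictCount-mono (c ∷ cs) x y y⊆x with 0ℚ ℚₚ.<? eval c x | 0ℚ ℚₚ.<? eval c y
... | yes _   | yes _   = s≤s (strictCount-mono cs x y (λ c′ → y⊆x c′ ∘ there))
... | yes _   | no  _   = ℕₚ.m≤n⇒m≤1+n (strictCount-mono cs x y (λ c′ → y⊆x c′ ∘ there))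
... | no  x≯0 | yes y>0 = ⊥-elim (x≯0 (y⊆x c (here refl) y>0))
... | no  _   | no  _   = strictCount-mono cs x y (λ c′ → y⊆x c′ ∘ there)

strictCount-mono-< : ∀ cs (x y : Pt r) → StrictIn cs y x →
                     ∀ {c} → c ∈ cs → 0ℚ ℚ.< eval c x → ¬ (0ℚ ℚ.< eval c y) → strictCount cs y < strictCount cs x
strictCount-mono-< (c ∷ cs) x y y⊆x (here refl) x>0 y≯0 with 0ℚ ℚₚ.<? eval c x | 0ℚ ℚₚ.<? eval c y
... | _       | yes y>0 = ⊥-elim (y≯0 y>0)
... | no  x≯0 | no  _   = ⊥-elim (x≯0 x>0)
... | yes _   | no  _   = s≤s (strictCount-mono cs x y (λ c′ → y⊆x c′ ∘ there))
strictCount-mono-< (c ∷ cs) x y y⊆x (there c′∈) x>0 y≯0 with 0ℚ ℚₚ.<? eval c x | 0ℚ ℚₚ.<? eval c y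
... | yes _   | yes _   = s≤s (strictCount-mono-< cs x y (λ c′ → y⊆x c′ ∘ there) c′∈ x>0 y≯0)
... | yes _   | no  _   = ℕₚ.m≤n⇒m≤1+n (strictCount-mono-< cs x y (λ c′ → y⊆x c′ ∘ there) c′∈ x>0 y≯0)
... | no  x≯0 | yes y>0 = ⊥-elim (x≯0 (y⊆x c (here refl) y>0))
... | no  _   | no  _   = strictCount-mono-< cs x y (λ c′ → y⊆x c′ ∘ there) c′∈ x>0 y≯0

Combination : Set
Combination = List (ℚ × Generator)

combine : Combination → Pt r
combine []             = zeroPt
combine ((θ , g) ∷ gs) = scale θ (gen g) ⊕ combine gs

Admissible : ℕ → ℚ × Generator → Set
Admissible r (θ , g) = 0ℚ ℚ.< θ × Valid r g

Decomposition : Pt r → Set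
Decomposition {r} x = Σ Combination λ gs → All (Admissible r) gs × x ≈ combine gs

-- Subtracting from x the largest multiple θ·g of a supporting generator that stays in the cone
-- makes the constraint attaining θ = min (eval c x / value c g) tight.
module Peel {r : ℕ} (x : Pt r) (x∈ : InCone x) (g : Generator) (valid : Valid r g)
            (supp : SupportedBy g x) where

  ratio : Constraint → ℚ
  ratio c = eval c x ÷ℕ value c g

  strict? : ∀ c → Dec (0 < value c g)
  strict? c = 0 ℕ.<? value c g

  tight : Constraint
  tight = argmin ratio (apexDrop g) (filter strict? (constraints r))

  tight-strict : tight ∈ constraints r × 0 < value tight g
  tight-strict = argmin-all ratio (apexDrop∈ g valid , apexDrop-pos g valid)
    (All.tabulate (∈-filter⁻ strict? {xs = constraints r}))

  θ : ℚ
  θ = ratio tight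

  θ-minimal : ∀ {c} → c ∈ constraints r → 0 < value c g → θ ℚ.≤ ratio c
  θ-minimal c∈ strict =
    All.lookup (f[argmin]≤f[xs] (apexDrop g) (filter strict? (constraints r))) (∈-filter⁺ strict? c∈ strict)

  θ-pos : 0ℚ ℚ.< θ
  θ-pos = ÷ℕ-pos (supp tight (proj₂ tight-strict)) (proj₂ tight-strict)

  θ-bounded : ∀ c → c ∈ constraints r → θ ℚ.* fromℕ (value c g) ℚ.≤ eval c x
  θ-bounded c c∈ with value c g in value≡
  ... | zero  = ℚₚ.≤-trans (ℚₚ.≤-reflexive (ℚₚ.*-zeroʳ θ)) (proj₁ x∈ c c∈)
  ... | suc n = ≤÷ℕ⇒*≤ (eval c x) (suc n) (s≤s z≤n)
                  (subst (λ v → θ ℚ.≤ eval c x ÷ℕ v) value≡ (θ-minimal c∈ (subst (0 <_) (sym value≡) (s≤s z≤n))))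

  rest : Pt r
  rest = scale (ℚ.- θ) (gen g) ⊕ x

  eval-rest : ∀ c → eval c rest ≡ eval c x ℚ.- θ ℚ.* fromℕ (value c g)
  eval-rest c = begin
    eval c rest                                     ≡⟨ dot-⊕-scale (normal c) (ℚ.- θ) (gen g) x ⟩
    ℚ.- θ ℚ.* eval c (gen {r} g) ℚ.+ eval c x       ≡⟨ cong (λ v → ℚ.- θ ℚ.* v ℚ.+ eval c x) (eval-gen g valid c) ⟩
    ℚ.- θ ℚ.* fromℕ (value c g) ℚ.+ eval c x        ≡⟨ reorder θ (fromℕ (value c g)) (eval c x) ⟩
    eval c x ℚ.- θ ℚ.* fromℕ (value c g)            ∎
    where
    open ≡-Reasoning
    reorder : ∀ t v e → ℚ.- t ℚ.* v ℚ.+ e ≡ e ℚ.- t ℚ.* v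
    reorder = solveℚ 3 (λ t v e → (:- t) :* v :+ e := e :- t :* v) refl

  rest-InCone : InCone rest
  rest-InCone =
    (λ c c∈ → subst (0ℚ ℚ.≤_) (sym (eval-rest c)) (p≤q⇒0≤q-p (θ-bounded c c∈))) ,
    (begin
      eval (dominance r) rest                                       ≡⟨ eval-rest (dominance r) ⟩
      eval (dominance r) x ℚ.- θ ℚ.* fromℕ (value (dominance r) g)  ≡⟨ cong₂ (λ u v → u ℚ.- θ ℚ.* fromℕ v)
                                                                         (proj₂ x∈) (dominance-balanced g valid) ⟩
      0ℚ ℚ.- θ ℚ.* 0ℚ                                               ≡⟨ cong (λ v → 0ℚ ℚ.- v) (ℚₚ.*-zeroʳ θ) ⟩
      0ℚ                                                            ∎)
    where open ≡-Reasoning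

  x≈θg+rest : x ≈ (scale θ (gen {r} g) ⊕ rest)
  x≈θg+rest = (λ i → split (proj₁ x i) (proj₁ (gen {r} g) i)) , (λ i → split (proj₂ x i) (proj₂ (gen {r} g) i))
    where
    split : ∀ u v → u ≡ θ ℚ.* v ℚ.+ (ℚ.- θ ℚ.* v ℚ.+ u)
    split = solveℚ 3 (λ t u v → u := t :* v :+ ((:- t) :* v :+ u)) refl θ

  rest-fewer : strictCount (constraints r) rest < strictCount (constraints r) x
  rest-fewer = strictCount-mono-< (constraints r) x rest rest⊆x
                 (proj₁ tight-strict) (supp tight (proj₂ tight-strict)) (ℚₚ.<-irrefl (sym rest-tight))
    where
    rest⊆x : StrictIn (constraints r) rest x
    rest⊆x c _ rest>0 = ℚₚ.<-≤-trans rest>0 (subst (ℚ._≤ eval c x) (sym (eval-rest c))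
      (0≤q⇒p-q≤p (*-nonNeg (ℚₚ.<⇒≤ θ-pos) (fromℕ-nonNeg (value c g)))))
    rest-tight : eval tight rest ≡ 0ℚ
    rest-tight = trans (eval-rest tight)
      (trans (cong (λ v → eval tight x ℚ.- v) (÷ℕ-*-cancel (eval tight x) (proj₂ tight-strict)))
             (ℚₚ.+-inverseʳ (eval tight x)))

decompose-< : ∀ n (x : Pt r) → InCone x → strictCount (constraints r) x < n → Decomposition x
decompose-< (suc n) x@(l , m) x∈ count<n with Support.zero-or-supported l m x∈
... | inj₁ x≈0                = [] , [] , x≈0
... | inj₂ (g , valid , supp) =
  let gs , admissible , rest≈ = decompose-< n rest rest-InCone (ℕₚ.<-≤-trans rest-fewer (ℕₚ.≤-pred count<n))
  in (θ , g) ∷ gs , (θ-pos , valid) ∷ admissible , ≈-trans x≈θg+rest (⊕-congˡ (scale θ (gen g)) rest≈)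
  where open Peel x x∈ g valid supp

decompose : (x : Pt r) → InCone x → Decomposition x
decompose {r} x x∈ = decompose-< (suc (strictCount (constraints r) x)) x x∈ ℕₚ.≤-refl

-- Faces and extremal rays

normalSum : List Constraint → Pt r
normalSum []       = zeroPt
normalSum (c ∷ cs) = normal c ⊕ normalSum cs

dot-normalSum-nonNeg : ∀ cs (y : Pt r) → (∀ c → c ∈ cs → 0ℚ ℚ.≤ eval c y) → 0ℚ ℚ.≤ dot (normalSum cs) y
dot-normalSum-nonNeg []       y _       = ℚₚ.≤-reflexive (sym (dot-zeroPtˡ y))
dot-normalSum-nonNeg (c ∷ cs) y nonNeg =
  subst (0ℚ ℚ.≤_) (sym (dot-⊕ˡ (normal c) (normalSum cs) y))
    (+-nonNeg (nonNeg c (here refl)) (dot-normalSum-nonNeg cs y (λ c′ → nonNeg c′ ∘ there)))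

dot-normalSum-pos : ∀ cs (y : Pt r) → (∀ c → c ∈ cs → 0ℚ ℚ.≤ eval c y) →
                    ∀ {c} → c ∈ cs → 0ℚ ℚ.< eval c y → 0ℚ ℚ.< dot (normalSum cs) y
dot-normalSum-pos (c ∷ cs) y nonNeg (here refl) pos =
  subst (0ℚ ℚ.<_) (sym (dot-⊕ˡ (normal c) (normalSum cs) y))
    (+-posˡ pos (dot-normalSum-nonNeg cs y (λ c′ → nonNeg c′ ∘ there)))
dot-normalSum-pos (c ∷ cs) y nonNeg (there c′∈) pos =
  subst (0ℚ ℚ.<_) (sym (dot-⊕ˡ (normal c) (normalSum cs) y))
    (+-posʳ (nonNeg c (here refl)) (dot-normalSum-pos cs y (λ c′ → nonNeg c′ ∘ there) c′∈ pos))

dot-normalSum-zero : ∀ cs (y : Pt r) → (∀ c → c ∈ cs → eval c y ≡ 0ℚ) → dot (normalSum cs) y ≡ 0ℚ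
dot-normalSum-zero []       y _     = dot-zeroPtˡ y
dot-normalSum-zero (c ∷ cs) y zeros = begin
  dot (normal c ⊕ normalSum cs) y        ≡⟨ dot-⊕ˡ (normal c) (normalSum cs) y ⟩
  eval c y ℚ.+ dot (normalSum cs) y      ≡⟨ cong₂ ℚ._+_ (zeros c (here refl))
                                                         (dot-normalSum-zero cs y (λ c′ → zeros c′ ∘ there)) ⟩
  0ℚ ℚ.+ 0ℚ                              ≡⟨ ℚₚ.+-identityʳ 0ℚ ⟩
  0ℚ                                     ∎
  where open ≡-Reasoning

vanishes? : ∀ g c → Dec (value c g ≡ 0)
vanishes? g c = value c g ℕ.≟ 0

hyperplane : Generator → Pt r
hyperplane {r} g = normalSum (filter (vanishes? g) (constraints r))

hyperplane-supporting : ∀ g → Supporting (hyperplane {r} g)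
hyperplane-supporting {r} g x x∈K = dot-normalSum-nonNeg (filter (vanishes? g) (constraints r)) x
  (λ c c∈ → proj₁ (InKostka⇒InCone x x∈K) c (proj₁ (∈-filter⁻ (vanishes? g) {xs = constraints r} c∈)))

hyperplane-gen : ∀ g → Valid r g → dot (hyperplane {r} g) (gen g) ≡ 0ℚ
hyperplane-gen {r} g valid = dot-normalSum-zero (filter (vanishes? g) (constraints r)) (gen {r} g)
  (λ c c∈ → trans (eval-gen g valid c) (cong fromℕ (proj₂ (∈-filter⁻ (vanishes? g) {xs = constraints r} c∈))))

hyperplane-other : ∀ g h → Valid r g → Valid r h → g ≢ h → 0ℚ ℚ.< dot (hyperplane {r} g) (gen h)
hyperplane-other {r} g h valid-g valid-h g≢h with separate g h valid-g valid-h g≢h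
... | c , c∈ , zero-on-g , pos-on-h = dot-normalSum-pos (filter (vanishes? g) (constraints r)) (gen {r} h)
  (λ c′ c′∈ → proj₁ (gen-InCone h valid-h) c′ (proj₁ (∈-filter⁻ (vanishes? g) {xs = constraints r} c′∈)))
  (∈-filter⁺ (vanishes? g) c∈ zero-on-g)
  (subst (0ℚ ℚ.<_) (sym (eval-gen h valid-h c)) (fromℕ-pos pos-on-h))

_≟ᴳ_ : (g h : Generator) → Dec (g ≡ h)
diagonal a   ≟ᴳ diagonal a′ with a ℕ.≟ a′
... | yes refl = yes refl
... | no  a≢a′ = no λ { refl → a≢a′ refl }
diagonal _   ≟ᴳ triple _ _ _ = no λ ()
triple _ _ _ ≟ᴳ diagonal _   = no λ ()
triple b a c ≟ᴳ triple b′ a′ c′ with b ℕ.≟ b′ | a ℕ.≟ a′ | c ℕ.≟ c′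
... | yes refl | yes refl | yes refl = yes refl
... | no  b≢b′ | _        | _        = no λ { refl → b≢b′ refl }
... | yes _    | no  a≢a′ | _        = no λ { refl → a≢a′ refl }
... | yes _    | yes _    | no  c≢c′ = no λ { refl → c≢c′ refl }

hyperplane-gen⇒≡ : ∀ g h → Valid r g → Valid r h → dot (hyperplane {r} g) (gen h) ≡ 0ℚ → h ≡ g
hyperplane-gen⇒≡ g h valid-g valid-h w·h≡0 with h ≟ᴳ g
... | yes h≡g = h≡g
... | no  h≢g = ⊥-elim (ℚₚ.<-irrefl (sym w·h≡0) (hyperplane-other g h valid-g valid-h (h≢g ∘ sym)))

weight : Combination → ℚ
weight []             = 0ℚ
weight ((θ , _) ∷ gs) = θ ℚ.+ weight gs

weight-nonNeg : ∀ gs → All (Admissible r) gs → 0ℚ ℚ.≤ weight gs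
weight-nonNeg []             []                = ℚₚ.≤-refl
weight-nonNeg ((θ , _) ∷ gs) ((θ>0 , _) ∷ adm) = +-nonNeg (ℚₚ.<⇒≤ θ>0) (weight-nonNeg gs adm)

combine-single : ∀ g gs → All (λ θh → proj₂ θh ≡ g) gs → combine {r} gs ≈ scale (weight gs) (gen g)
combine-single g []              []            = ≈-sym (scale-zero (gen g))
combine-single g ((θ , .g) ∷ gs) (refl ∷ all≡) =
  ≈-trans (⊕-congˡ (scale θ (gen g)) (combine-single g gs all≡)) (scale-+ θ (weight gs) (gen g))

NonNegOnGenerators : ℕ → Pt r → Set
NonNegOnGenerators r w = ∀ g → Valid r g → 0ℚ ℚ.≤ dot w (gen g)

Supporting⇒NonNegOnGenerators : (w : Pt r) → Supporting w → NonNegOnGenerators r w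
Supporting⇒NonNegOnGenerators w supporting g valid =
  supporting (gen g) (InCone⇒InKostka (gen g) (gen-InCone g valid))

dot-combine-nonNeg : (w : Pt r) → NonNegOnGenerators r w →
                     ∀ gs → All (Admissible r) gs → 0ℚ ℚ.≤ dot w (combine gs)
dot-combine-nonNeg w _       []             []                    = ℚₚ.≤-reflexive (sym (dot-zeroPtʳ w))
dot-combine-nonNeg w nonNeg ((θ , g) ∷ gs) ((θ>0 , valid) ∷ adm) =
  subst (0ℚ ℚ.≤_) (sym (dot-⊕-scale w θ (gen g) (combine gs)))
  (+-nonNeg (*-nonNeg (ℚₚ.<⇒≤ θ>0) (nonNeg g valid)) (dot-combine-nonNeg w nonNeg gs adm))

dot-combine-zero : (w : Pt r) → NonNegOnGenerators r w → ∀ gs → All (Admissible r) gs →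
                   dot w (combine gs) ≡ 0ℚ → All (λ θg → dot w (gen (proj₂ θg)) ≡ 0ℚ) gs
dot-combine-zero w nonNeg []             []                    _     = []
dot-combine-zero w nonNeg ((θ , g) ∷ gs) ((θ>0 , valid) ∷ adm) w·x≡0 =
  pos*q≡0⇒q≡0 θ>0 (proj₁ both≡0) ∷ dot-combine-zero w nonNeg gs adm (proj₂ both≡0)
  where
  both≡0 : θ ℚ.* dot w (gen g) ≡ 0ℚ × dot w (combine gs) ≡ 0ℚ
  both≡0 = nonNeg+nonNeg≡0 (*-nonNeg (ℚₚ.<⇒≤ θ>0) (nonNeg g valid)) (dot-combine-nonNeg w nonNeg gs adm)
    (trans (sym (dot-⊕-scale w θ (gen g) (combine gs))) w·x≡0)

ray-symmetric : {u v : Pt r} → ¬ (v ≈ zeroPt) → Ray u v → Ray v u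
ray-symmetric {u = u} v≉0 (t , t≥0 , v≈tu) with ℚₚ.<-cmp 0ℚ t
... | tri≈ _ 0≡t _ = ⊥-elim (v≉0 (≈-trans v≈tu (subst (λ s → scale s u ≈ zeroPt) 0≡t (scale-zero u))))
... | tri> _ _ t<0 = ⊥-elim (ℚₚ.<-irrefl refl (ℚₚ.<-≤-trans t<0 t≥0))
... | tri< t>0 _ _ = ℚ.1/ t , ℚₚ.<⇒≤ (ℚₚ.positive⁻¹ _ {{ℚₚ.1/pos⇒pos t}}) ,
                     (λ i → sym (trans (cong (ℚ.1/ t ℚ.*_) (proj₁ v≈tu i)) (cancel (proj₁ u i)))) ,
                     (λ i → sym (trans (cong (ℚ.1/ t ℚ.*_) (proj₂ v≈tu i)) (cancel (proj₂ u i))))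
  where
  instance
    t-pos : ℚ.Positive t
    t-pos = ℚ.positive t>0
    t≢0 : ℚ.NonZero t
    t≢0 = ℚₚ.pos⇒nonZero t
  cancel : ∀ p → ℚ.1/ t ℚ.* (t ℚ.* p) ≡ p
  cancel p = trans (sym (ℚₚ.*-assoc (ℚ.1/ t) t p)) (trans (cong (ℚ._* p) (ℚₚ.*-inverseˡ t)) (ℚₚ.*-identityˡ p))

InCone-ray : {u x : Pt r} → InCone u → Ray u x → InCone x
InCone-ray {r} {u} {x} (nonNeg , balanced) (t , t≥0 , x≈tu) =
  (λ c c∈ → subst (0ℚ ℚ.≤_) (sym (eval-x c)) (*-nonNeg t≥0 (nonNeg c c∈))) ,
  trans (eval-x (dominance r)) (trans (cong (t ℚ.*_) balanced) (ℚₚ.*-zeroʳ t))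
  where
  eval-x : ∀ c → eval c x ≡ t ℚ.* eval c u
  eval-x c = trans (dot-congʳ (normal c) x≈tu) (dot-scaleʳ (normal c) t u)

gen-nonZero : ∀ g → Valid r g → ¬ (gen {r} g ≈ zeroPt)
gen-nonZero {r} g valid gen≈0 =
  ℚₚ.<-irrefl (sym eval≡0)
    (subst (0ℚ ℚ.<_) (sym (eval-gen g valid (apexDrop g))) (fromℕ-pos (apexDrop-pos g valid)))
  where
  eval≡0 : eval (apexDrop g) (gen {r} g) ≡ 0ℚ
  eval≡0 = trans (dot-congʳ (normal (apexDrop g)) gen≈0) (dot-zeroPtʳ (normal {r} (apexDrop g)))

face⇒ray : ∀ g → Valid r g → ∀ x → Face (hyperplane {r} g) x → Ray (gen g) x
face⇒ray {r} g valid x (x∈K , w·x≡0) = on-face (decompose x (InKostka⇒InCone x x∈K))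
  where
  w : Pt r
  w = hyperplane g
  on-face : Decomposition x → Ray (gen g) x
  on-face (gs , adm , x≈) = weight gs , weight-nonNeg gs adm , ≈-trans x≈ (combine-single g gs all≡g)
    where
    all≡g : All (λ θh → proj₂ θh ≡ g) gs
    all≡g = All.zipWith (λ ((_ , valid-h) , w·h≡0) → hyperplane-gen⇒≡ g _ valid valid-h w·h≡0)
      (adm , dot-combine-zero w (Supporting⇒NonNegOnGenerators w (hyperplane-supporting g)) gs adm
               (trans (sym (dot-congʳ w x≈)) w·x≡0))

hyperplane-ray : ∀ g → Valid r g → ∀ {x} → Ray (gen g) x → dot (hyperplane {r} g) x ≡ 0ℚ
hyperplane-ray {r} g valid {x} (t , _ , x≈tg) = begin
  dot (hyperplane g) x                      ≡⟨ dot-congʳ (hyperplane g) x≈tg ⟩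
  dot (hyperplane g) (scale t (gen {r} g))  ≡⟨ dot-scaleʳ (hyperplane {r} g) t (gen g) ⟩
  t ℚ.* dot (hyperplane {r} g) (gen g)      ≡⟨ cong (t ℚ.*_) (hyperplane-gen g valid) ⟩
  t ℚ.* 0ℚ                                  ≡⟨ ℚₚ.*-zeroʳ t ⟩
  0ℚ                                        ∎
  where open ≡-Reasoning

ray⇒face : ∀ g → Valid r g → ∀ x → Ray (gen g) x → Face (hyperplane {r} g) x
ray⇒face g valid x ray = InCone⇒InKostka x (InCone-ray (gen-InCone g valid) ray) , hyperplane-ray g valid ray

gen-extremal : ∀ g → Valid r g → IsExtremalRay (gen {r} g)
gen-extremal g valid =
  gen-nonZero g valid , hyperplane g , hyperplane-supporting g , λ x → face⇒ray g valid x , ray⇒face g valid x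

gen-injective : ∀ g h → Valid r g → Valid r h → SameRay (gen {r} g) (gen h) → g ≡ h
gen-injective g h valid-g valid-h (g→h , _) =
  sym (hyperplane-gen⇒≡ g h valid-g valid-h (hyperplane-ray g valid-g g→h))

ray-refl : (u : Pt r) → Ray u u
ray-refl u = 1ℚ , ℚₚ.<⇒≤ (ℚₚ.positive⁻¹ 1ℚ) , ≈-sym (scale-one u)

-- An extremal ray is spanned by the first generator in a decomposition of its spanning vector,
-- since that generator lies on the face cut out by the ray's supporting hyperplane.
extremal⇒gen : (u : Pt r) → IsExtremalRay u → Σ Generator λ g → Valid r g × SameRay u (gen g)
extremal⇒gen {r} u (u≉0 , w , supporting , face⇔ray) = from (decompose u (InKostka⇒InCone u (proj₁ u-on-face)))
  where
  u-on-face : Face w u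
  u-on-face = proj₂ (face⇔ray u) (ray-refl u)
  from : Decomposition u → Σ Generator λ g → Valid r g × SameRay u (gen g)
  from ([]           , _                     , u≈0) = ⊥-elim (u≉0 u≈0)
  from ((θ , g) ∷ gs , (θ>0 , valid) ∷ adm , u≈)  = g , valid , u→g , ray-symmetric (gen-nonZero g valid) u→g
    where
    w·g≡0 : dot w (gen g) ≡ 0ℚ
    w·g≡0 = All.head (dot-combine-zero w (Supporting⇒NonNegOnGenerators w supporting) ((θ , g) ∷ gs)
                       ((θ>0 , valid) ∷ adm) (trans (sym (dot-congʳ w u≈)) (proj₂ u-on-face)))
    u→g : Ray u (gen g)
    u→g = proj₁ (face⇔ray (gen g)) (InCone⇒InKostka (gen g) (gen-InCone g valid) , w·g≡0)

-- Counting the generators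

length-map-upTo : ∀ {A : Set} (f : ℕ → A) n → length (map f (upTo n)) ≡ n
length-map-upTo f n = trans (Listₚ.length-map f (upTo n)) (Listₚ.length-upTo n)

pairsBelow : ℕ → List (ℕ × ℕ)
pairsBelow zero    = []
pairsBelow (suc n) = pairsBelow n ++ map (_, n) (upTo n)

withTop : ℕ → ℕ × ℕ → Generator
withTop c (b , a) = triple b a c

triplesUpTo : ℕ → List Generator
triplesUpTo zero    = []
triplesUpTo (suc r) = triplesUpTo r ++ map (withTop (suc r)) (pairsBelow (suc r))

generators : ℕ → List Generator
generators r = triplesUpTo r ++ map (diagonal ∘ suc) (upTo r)

length-pairsBelow : ∀ n → length (pairsBelow n) ≡ n C 2
length-pairsBelow zero    = refl
length-pairsBelow (suc n) = begin
  length (pairsBelow n ++ map (_, n) (upTo n))          ≡⟨ Listₚ.length-++ (pairsBelow n) ⟩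
  length (pairsBelow n) + length (map (_, n) (upTo n))  ≡⟨ cong₂ _+_ (length-pairsBelow n)
                                                                     (length-map-upTo (_, n) n) ⟩
  n C 2 + n                                             ≡⟨ ℕₚ.+-comm (n C 2) n ⟩
  n + n C 2                                             ≡⟨ cong (_+ n C 2) (sym (nC1≡n n)) ⟩
  n C 1 + n C 2                                         ≡⟨ nCk+nC[k+1]≡[n+1]C[k+1] n 1 ⟩
  suc n C 2                                             ∎
  where open ≡-Reasoning

length-triplesUpTo : ∀ r → length (triplesUpTo r) ≡ suc r C 3
length-triplesUpTo zero    = refl
length-triplesUpTo (suc r) = begin
  length (triplesUpTo r ++ map (withTop (suc r)) (pairsBelow (suc r)))
    ≡⟨ Listₚ.length-++ (triplesUpTo r) ⟩
  length (triplesUpTo r) + length (map (withTop (suc r)) (pairsBelow (suc r)))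
    ≡⟨ cong₂ _+_ (length-triplesUpTo r)
         (trans (Listₚ.length-map (withTop (suc r)) (pairsBelow (suc r))) (length-pairsBelow (suc r))) ⟩
  suc r C 3 + suc r C 2
    ≡⟨ ℕₚ.+-comm (suc r C 3) (suc r C 2) ⟩
  suc r C 2 + suc r C 3
    ≡⟨ nCk+nC[k+1]≡[n+1]C[k+1] (suc r) 2 ⟩
  suc (suc r) C 3 ∎
  where open ≡-Reasoning

length-generators : ∀ r → length (generators r) ≡ r C 3 + r C 2 + r C 1
length-generators r = begin
  length (triplesUpTo r ++ map (diagonal ∘ suc) (upTo r))
    ≡⟨ Listₚ.length-++ (triplesUpTo r) ⟩
  length (triplesUpTo r) + length (map (diagonal ∘ suc) (upTo r))
    ≡⟨ cong₂ _+_ (length-triplesUpTo r) (length-map-upTo (diagonal ∘ suc) r) ⟩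
  suc r C 3 + r
    ≡⟨ cong₂ _+_ (sym (nCk+nC[k+1]≡[n+1]C[k+1] r 2)) (sym (nC1≡n r)) ⟩
  r C 2 + r C 3 + r C 1
    ≡⟨ cong (_+ r C 1) (ℕₚ.+-comm (r C 2) (r C 3)) ⟩
  r C 3 + r C 2 + r C 1 ∎
  where open ≡-Reasoning

∈-pairsBelow⁻ : ∀ {n b a} → (b , a) ∈ pairsBelow n → b < a × a < n
∈-pairsBelow⁻ {suc n} ba∈ with ∈-++⁻ (pairsBelow n) ba∈
... | inj₁ ba∈old = map-< (∈-pairsBelow⁻ ba∈old)
  where
  map-< : ∀ {b a} → b < a × a < n → b < a × a < suc n
  map-< (b<a , a<n) = b<a , ℕₚ.m≤n⇒m≤1+n a<n
... | inj₂ ba∈new with ∈-map⁻ (_, n) ba∈new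
...   | b , b∈ , refl = ∈-upTo⁻ b∈ , ℕₚ.n<1+n n

∈-pairsBelow⁺ : ∀ {n b a} → b < a → a < n → (b , a) ∈ pairsBelow n
∈-pairsBelow⁺ {suc n} {b} {a} b<a a<n+1 with a ℕ.≟ n
... | yes refl = ∈-++⁺ʳ (pairsBelow a) (∈-map⁺ (_, a) (∈-upTo⁺ b<a))
... | no  a≢n  = ∈-++⁺ˡ (∈-pairsBelow⁺ b<a (ℕₚ.≤∧≢⇒< (ℕₚ.≤-pred a<n+1) a≢n))

Valid-suc : ∀ g → Valid r g → Valid (suc r) g
Valid-suc (diagonal a)   (1≤a , a≤r)       = 1≤a , ℕₚ.m≤n⇒m≤1+n a≤r
Valid-suc (triple b a c) (b<a , a<c , c≤r) = b<a , a<c , ℕₚ.m≤n⇒m≤1+n c≤r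

∈-triplesUpTo⁻ : ∀ {r g} → g ∈ triplesUpTo r → Valid r g
∈-triplesUpTo⁻ {suc r} g∈ with ∈-++⁻ (triplesUpTo r) g∈
... | inj₁ g∈old = Valid-suc _ (∈-triplesUpTo⁻ g∈old)
... | inj₂ g∈new with ∈-map⁻ (withTop (suc r)) g∈new
...   | (b , a) , ba∈ , refl = proj₁ (∈-pairsBelow⁻ {suc r} ba∈) , proj₂ (∈-pairsBelow⁻ {suc r} ba∈) , ℕₚ.≤-refl

∈-triplesUpTo⁺ : ∀ {r b a c} → Valid r (triple b a c) → triple b a c ∈ triplesUpTo r
∈-triplesUpTo⁺ {zero}  (b<a , a<c , c≤0) = ⊥-elim (ℕₚ.n≮0 (ℕₚ.<-≤-trans a<c c≤0))
∈-triplesUpTo⁺ {suc r} {b} {a} {c} (b<a , a<c , c≤r+1) with c ℕ.≟ suc r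
... | yes refl = ∈-++⁺ʳ (triplesUpTo r) (∈-map⁺ (withTop (suc r)) (∈-pairsBelow⁺ b<a a<c))
... | no  c≢r+1 = ∈-++⁺ˡ (∈-triplesUpTo⁺ (b<a , a<c , ℕₚ.≤-pred (ℕₚ.≤∧≢⇒< c≤r+1 c≢r+1)))

∈-generators⁻ : ∀ {r g} → g ∈ generators r → Valid r g
∈-generators⁻ {r} g∈ with ∈-++⁻ (triplesUpTo r) g∈
... | inj₁ g∈triples = ∈-triplesUpTo⁻ g∈triples
... | inj₂ g∈diagonals with ∈-map⁻ (diagonal ∘ suc) g∈diagonals
...   | k , k∈ , refl = s≤s z≤n , ∈-upTo⁻ k∈

∈-generators⁺ : ∀ {r} g → Valid r g → g ∈ generators r
∈-generators⁺     (triple b a c)     valid     = ∈-++⁺ˡ (∈-triplesUpTo⁺ valid)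
∈-generators⁺ {r} (diagonal (suc k)) (_ , a≤r) =
  ∈-++⁺ʳ (triplesUpTo r) (∈-map⁺ (diagonal ∘ suc) (∈-upTo⁺ a≤r))

pairsBelow-unique : ∀ n → Unique (pairsBelow n)
pairsBelow-unique zero    = []
pairsBelow-unique (suc n) =
  Uniqueₚ.++⁺ (pairsBelow-unique n) (Uniqueₚ.map⁺ (cong proj₁) (Uniqueₚ.upTo⁺ n)) disjoint
  where
  disjoint : ∀ {ba} → ¬ (ba ∈ pairsBelow n × ba ∈ map (_, n) (upTo n))
  disjoint (ba∈old , ba∈new) with ∈-map⁻ (_, n) ba∈new
  ... | _ , _ , refl = ℕₚ.<-irrefl refl (proj₂ (∈-pairsBelow⁻ ba∈old))

triplesUpTo-unique : ∀ r → Unique (triplesUpTo r)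
triplesUpTo-unique zero    = []
triplesUpTo-unique (suc r) =
  Uniqueₚ.++⁺ (triplesUpTo-unique r) (Uniqueₚ.map⁺ withTop-injective (pairsBelow-unique (suc r))) disjoint
  where
  withTop-injective : ∀ {p q} → withTop (suc r) p ≡ withTop (suc r) q → p ≡ q
  withTop-injective {_ , _} {_ , _} refl = refl
  disjoint : ∀ {g} → ¬ (g ∈ triplesUpTo r × g ∈ map (withTop (suc r)) (pairsBelow (suc r)))
  disjoint (g∈old , g∈new) with ∈-map⁻ (withTop (suc r)) g∈new
  ... | _ , _ , refl = ℕₚ.<-irrefl refl (proj₂ (proj₂ (∈-triplesUpTo⁻ g∈old)))

generators-unique : ∀ r → Unique (generators r)
generators-unique r = Uniqueₚ.++⁺ (triplesUpTo-unique r) (Uniqueₚ.map⁺ suc-injective (Uniqueₚ.upTo⁺ r)) disjoint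
  where
  suc-injective : ∀ {k k′} → diagonal (suc k) ≡ diagonal (suc k′) → k ≡ k′
  suc-injective refl = refl
  no-diagonal : ∀ r {a} → ¬ (diagonal a ∈ triplesUpTo r)
  no-diagonal (suc r) d∈ with ∈-++⁻ (triplesUpTo r) d∈
  ... | inj₁ d∈old = no-diagonal r d∈old
  ... | inj₂ d∈new with ∈-map⁻ (withTop (suc r)) d∈new
  ...   | _ , _ , ()
  disjoint : ∀ {g} → ¬ (g ∈ triplesUpTo r × g ∈ map (diagonal ∘ suc) (upTo r))
  disjoint (g∈triples , g∈diagonals) with ∈-map⁻ (diagonal ∘ suc) g∈diagonals
  ... | _ , _ , refl = no-diagonal r g∈triples

lookup-injective : ∀ {A : Set} {xs : List A} → Unique xs → ∀ i j → lookup xs i ≡ lookup xs j → i ≡ j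
lookup-injective (_ ∷ _)      Fin.zero    Fin.zero    _  = refl
lookup-injective (x∉xs ∷ _)   Fin.zero    (Fin.suc j) x≡ = ⊥-elim (All.lookup x∉xs (∈-lookup j) x≡)
lookup-injective (x∉xs ∷ _)   (Fin.suc i) Fin.zero    ≡x = ⊥-elim (All.lookup x∉xs (∈-lookup i) (sym ≡x))
lookup-injective (_ ∷ unique) (Fin.suc i) (Fin.suc j) eq = cong Fin.suc (lookup-injective unique i j eq)

extremalRays-enumerated : ∀ r → HasExactlyNExtremalRays r (length (generators r))
extremalRays-enumerated r = gen ∘ lookup (generators r) , extremal , distinct , complete
  where
  valid : ∀ i → Valid r (lookup (generators r) i)
  valid i = ∈-generators⁻ (∈-lookup i)
  extremal : ∀ i → IsExtremalRay (gen (lookup (generators r) i))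
  extremal i = gen-extremal _ (valid i)
  distinct : ∀ i j → SameRay (gen (lookup (generators r) i)) (gen (lookup (generators r) j)) → i ≡ j
  distinct i j same = lookup-injective (generators-unique r) i j (gen-injective _ _ (valid i) (valid j) same)
  complete : ∀ u → IsExtremalRay u → ∃ λ i → SameRay u (gen (lookup (generators r) i))
  complete u u-extremal = position (extremal⇒gen u u-extremal)
    where
    position : Σ Generator (λ g → Valid r g × SameRay u (gen g)) →
               ∃ λ i → SameRay u (gen (lookup (generators r) i))
    position (g , g-valid , same) = index g∈ , subst (SameRay u ∘ gen) (lookup-index g∈) same
      where
      g∈ : g ∈ generators r
      g∈ = ∈-generators⁺ g g-valid

corollary1p6 : (r : ℕ) → 1 ≤ r →
    HasExactlyNExtremalRays r (r C 3 + r C 2 + r C 1)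
corollary1p6 r _ = subst (HasExactlyNExtremalRays r) (length-generators r) (extremalRays-enumerated r)
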